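{- Let $w\in S_n$ avoid the patterns $3412$ and $4231$. Then the inversion graph $G_w$ is chordal and has a nice perfect elimination ordering. Moreover $R_w(q)=[e_1+1]_q\,[e_2+1]_q\cdots[e_n+1]_q$, where $e_1,\dots,e_n$ are the exponents of $G_w$.
   Context: The inversion graph $G_w$ has vertices $\{1,\dots,n\}$ and edges $\{i,j\}$ for $i<j$ with $w(i)>w(j)$. A graph is chordal if every cycle with at least four vertices has a chord. A perfect elimination ordering $v_1,\dots,v_n$ of a graph is an ordering of its vertices in which, for each $i$, the neighbors of $v_i$ among $v_1,\dots,v_{i-1}$ form a clique; it is nice if for each $i$ these neighbors are either all greater than $v_i$ or all less than $v_i$. The exponents of a chordal graph are the numbers $e_i$ = number of neighbors of $v_i$ among $v_1,\dots,v_{i-1}$ for a perfect elimination ordering (as a multiset they are independent of the ordering, being the roots of the chromatic polynomial). $R_G(q)=\sum_{\mathcal{O}}q^{\mathrm{des}(\mathcal{O})}$ over acyclic orientations $\mathcal{O}$ of $G$, $\mathrm{des}(\mathcal{O})$ = number of edges oriented $i\to j$ with $i>j$; $R_w(q)=R_{G_w}(q)$; $[a]_q=1+q+\cdots+q^{a-1}$. -}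

module Defs where

open import Data.Nat as ℕ using (ℕ; zero; suc; _+_; _*_; _^_)
import Data.Nat.Properties as ℕP
open import Data.Fin using (Fin; zero; suc; toℕ; fromℕ<; _<_)
open import Data.Fin.Properties using (_<?_; toℕ≤pred[n])
open import Data.Fin.Permutation using (Permutation′; _⟨$⟩ʳ_)
open import Data.Bool using (Bool; true; false; T; if_then_else_)
open import Data.Vec using (Vec; lookup)
open import Data.List using (List; map; upTo; allFin)
open import Data.Nat.ListAction using (sum; product)
open import Data.List.Membership.Propositional using (_∈_)
open import Data.List.Relation.Unary.Unique.Propositional using (Unique)
open import Data.Product using (Σ; ∃; _×_; _,_)
open import Data.Sum using (_⊎_)
open import Data.Empty using (⊥)
open import Relation.Nullary using (¬_; Dec; yes; no)
open import Relation.Nullary.Decidable using (isYes; _×-dec_; _⊎-dec_)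
open import Relation.Binary.PropositionalEquality using (_≡_; _≢_)
open import Function.Definitions using (Injective)
open import Function.Bundles using (_⇔_)

-- Permutations w ∈ S_n, acting on {1..n} represented as Fin n
-- (0-based; only the relative order of positions/values matters).

S : ℕ → Set
S = Permutation′

Contains3412 : ∀ {n} → S n → Set
Contains3412 {n} w = Σ (Fin n) λ i → Σ (Fin n) λ j → Σ (Fin n) λ k → Σ (Fin n) λ l →
  i < j × j < k × k < l ×
  (w ⟨$⟩ʳ k) < (w ⟨$⟩ʳ l) × (w ⟨$⟩ʳ l) < (w ⟨$⟩ʳ i) × (w ⟨$⟩ʳ i) < (w ⟨$⟩ʳ j)

Contains4231 : ∀ {n} → S n → Set
Contains4231 {n} w = Σ (Fin n) λ i → Σ (Fin n) λ j → Σ (Fin n) λ k → Σ (Fin n) λ l →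
  i < j × j < k × k < l ×
  (w ⟨$⟩ʳ l) < (w ⟨$⟩ʳ j) × (w ⟨$⟩ʳ j) < (w ⟨$⟩ʳ k) × (w ⟨$⟩ʳ k) < (w ⟨$⟩ʳ i)

Inv : ∀ {n} → S n → Fin n → Fin n → Set
Inv w i j = i < j × (w ⟨$⟩ʳ j) < (w ⟨$⟩ʳ i)

Adj : ∀ {n} → S n → Fin n → Fin n → Set
Adj w i j = Inv w i j ⊎ Inv w j i

adj? : ∀ {n} (w : S n) (i j : Fin n) → Dec (Adj w i j)
adj? w i j = (i <? j ×-dec (w ⟨$⟩ʳ j) <? (w ⟨$⟩ʳ i))
          ⊎-dec (j <? i ×-dec (w ⟨$⟩ʳ i) <? (w ⟨$⟩ʳ j))

next : ∀ {m} → Fin (suc m) → Fin (suc m)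
next {m} t with toℕ t ℕ.≟ m
... | yes _ = zero
... | no t≢m = fromℕ< (ℕ.s≤s (ℕP.≤∧≢⇒< (toℕ≤pred[n] t) t≢m))

IsCycle : ∀ {n} → S n → (k : ℕ) → (Fin (4 + k) → Fin n) → Set
IsCycle w k c = Injective _≡_ _≡_ c × (∀ t → Adj w (c t) (c (next t)))

HasChord : ∀ {n} → S n → (k : ℕ) → (Fin (4 + k) → Fin n) → Set
HasChord {n} w k c = Σ (Fin (4 + k)) λ s → Σ (Fin (4 + k)) λ t →
  s ≢ t × next s ≢ t × next t ≢ s × Adj w (c s) (c t)

Chordal : ∀ {n} → S n → Set
Chordal w = ∀ k c → IsCycle w k c → HasChord w k c

-- Perfect elimination orderings.  An ordering v_1,…,v_n is a bijection
-- σ : positions → vertices, v_i = σ ⟨$⟩ʳ i.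

EarlierNbr : ∀ {n} → S n → Permutation′ n → Fin n → Fin n → Set
EarlierNbr w σ i j = j < i × Adj w (σ ⟨$⟩ʳ i) (σ ⟨$⟩ʳ j)

IsPEO : ∀ {n} → S n → Permutation′ n → Set
IsPEO w σ = ∀ i j k → EarlierNbr w σ i j → EarlierNbr w σ i k → j ≢ k →
  Adj w (σ ⟨$⟩ʳ j) (σ ⟨$⟩ʳ k)

IsNicePEO : ∀ {n} → S n → Permutation′ n → Set
IsNicePEO w σ = IsPEO w σ ×
  (∀ i → (∀ j → EarlierNbr w σ i j → (σ ⟨$⟩ʳ i) < (σ ⟨$⟩ʳ j))
       ⊎ (∀ j → EarlierNbr w σ i j → (σ ⟨$⟩ʳ j) < (σ ⟨$⟩ʳ i)))

exponent : ∀ {n} → S n → Permutation′ n → Fin n → ℕ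
exponent {n} w σ i =
  sum (map (λ j → if isYes (j <? i ×-dec adj? w (σ ⟨$⟩ʳ i) (σ ⟨$⟩ʳ j)) then 1 else 0)
           (allFin n))

-- Acyclic orientations.  An orientation is an n×n Boolean matrix o,
-- o[i][j] = true meaning the edge {i,j} is oriented i → j.

Orientation : ℕ → Set
Orientation n = Vec (Vec Bool n) n

_⇀[_]_ : ∀ {n} → Fin n → Orientation n → Fin n → Set
i ⇀[ o ] j = T (lookup (lookup o i) j)

IsOrientation : ∀ {n} → S n → Orientation n → Set
IsOrientation w o = ∀ i j →
  (Adj w i j → (i ⇀[ o ] j × ¬ (j ⇀[ o ] i)) ⊎ (¬ (i ⇀[ o ] j) × j ⇀[ o ] i)) ×
  (¬ Adj w i j → ¬ (i ⇀[ o ] j))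

HasDirectedCycle : ∀ {n} → Orientation n → Set
HasDirectedCycle {n} o = Σ ℕ λ m → Σ (Fin (suc m) → Fin n) λ c →
  Injective _≡_ _≡_ c × (∀ t → c t ⇀[ o ] c (next t))

IsAcyclicOrientation : ∀ {n} → S n → Orientation n → Set
IsAcyclicOrientation w o = IsOrientation w o × ¬ HasDirectedCycle o

des : ∀ {n} → Orientation n → ℕ
des {n} o = sum (map (λ i → sum (map (λ j →
  if isYes (j <? i) then (if lookup (lookup o i) j then 1 else 0) else 0)
  (allFin n))) (allFin n))

EnumeratesAcyclicOrientations : ∀ {n} → S n → List (Orientation n) → Set
EnumeratesAcyclicOrientations {n} w L =
  Unique L × (∀ (o : Orientation n) → (o ∈ L) ⇔ IsAcyclicOrientation w o)

-- R_w(q) = Σ_{acyclic o} q^{des o}, computed from such an enumeration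
R-via : ∀ {n} → List (Orientation n) → ℕ → ℕ
R-via L q = sum (map (λ o → q ^ des o) L)

[_]_ : ℕ → ℕ → ℕ
[ a ] q = sum (map (q ^_) (upTo a))

expProduct : ∀ {n} → S n → Permutation′ n → ℕ → ℕ
expProduct {n} w σ q = product (map (λ i → [ exponent w σ i + 1 ] q) (allFin n))

module Submission where

-- The proof runs over the induced subgraphs G_w[U], U ⊆ {1,…,n}.
-- (1) Extension: if u is a nice simplicial vertex of G[U] of degree d, the
--     acyclic orientations of G[U] are obtained, each once, from those of
--     G[U ─ u] by cutting the clique of neighbours of u (ordered by the
--     orientation) at one of d+1 heights, the cut at height p adding p
--     descents; so R_{G[U]} = [d+1]_q · R_{G[U ─ u]}.  Acyclicity is
--     certified by potentials (functions increasing along arrows).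
-- (2) Pattern avoidance: the last or the highest vertex of U is nice
--     simplicial, since two obstructions would form a 3412 or 4231 pattern.
-- (3) By induction on |U|, G[U] has an enumeration of its acyclic
--     orientations and, by exchanging deletions, R_{G[U]} factors off
--     [deg_U v + 1]_q at every simplicial v; peeling off the last vertex of a
--     perfect elimination ordering gives the product formula.
-- (4) Choosing nice vertices from the back gives a nice perfect elimination
--     ordering, and a perfect elimination ordering forces chordality.

open import Defs
open import Data.Nat as ℕ using (ℕ; zero; suc; _+_; _*_; _∸_; _^_; _≤_; _<ᵇ_; z≤n; s≤s)
import Data.Nat.Properties as NP
open import Data.Nat.Tactic.RingSolver using (solve-∀)
open import Data.Nat.ListAction using (sum; product)
open import Data.Nat.ListAction.Properties using (sum-++; sum-↭)
open import Data.Bool using (Bool; true; false; T; if_then_else_; _∧_; not)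
open import Data.Bool.Properties using (T-∧; T-≡; T?; ∧-zeroʳ; ∧-identityʳ; not-involutive)
open import Data.Fin as F using (Fin; zero; suc; toℕ; fromℕ; fromℕ<; inject₁)
import Data.Fin.Properties as FP
open import Data.Fin.Permutation as Perm using (Permutation′; _⟨$⟩ʳ_; _⟨$⟩ˡ_; inverseˡ; inverseʳ; _∘ₚ_; transpose)
import Data.Fin.Permutation.Components as PC
open import Data.Vec using (lookup; tabulate)
import Data.Vec.Properties as VP
open import Data.List as L using (List; []; _∷_; map; allFin; upTo; _++_; cartesianProduct)
open import Data.List.Properties using (map-++; map-∘; map-cong)
open import Data.List.Extrema.Nat using (max; xs≤max; max≤v⁺)
open import Data.List.Membership.Propositional using (_∈_)
open import Data.List.Membership.Propositional.Properties
  using (∈-allFin; ∈-map⁺; ∈-map⁻; ∈-cartesianProduct⁺; ∈-cartesianProduct⁻; ∈-upTo⁺; ∈-upTo⁻)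
open import Data.List.Membership.Propositional.Properties.WithK using (unique∧set⇒bag)
open import Data.List.Relation.Binary.BagAndSetEquality using (∼bag⇒↭)
import Data.List.Relation.Binary.Permutation.Propositional.Properties as ↭P
open import Data.List.Relation.Unary.All as All using (All; []; _∷_)
import Data.List.Relation.Unary.All.Properties as AllP
open import Data.List.Relation.Unary.AllPairs using ([]; _∷_)
open import Data.List.Relation.Unary.Any using (here; there)
open import Data.List.Relation.Unary.Unique.Propositional using (Unique)
import Data.List.Relation.Unary.Unique.Propositional.Properties as UniqueP
open import Data.Product using (Σ; _×_; _,_; proj₁; proj₂; map₂; uncurry)
open import Data.Sum using (_⊎_; inj₁; inj₂; [_,_]′)
open import Data.Empty using (⊥; ⊥-elim)
open import Data.Unit using (tt)
open import Relation.Nullary using (¬_; Dec; yes; no)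
open import Relation.Nullary.Decidable using (isYes; _×-dec_; ¬?; decidable-stable; toWitness; fromWitness)
open import Relation.Binary.Definitions using (tri<; tri≈; tri>)
open import Relation.Binary.PropositionalEquality hiding ([_])
open import Function.Base using (_∘_)
open import Function.Bundles using (_⇔_; mk⇔; Equivalence)
open import Function.Definitions using (Injective)

module _ {a} {A : Set a} where

  sum-cong : ∀ (f g : A → ℕ) xs → (∀ x → x ∈ xs → f x ≡ g x) →
             sum (map f xs) ≡ sum (map g xs)
  sum-cong f g [] _ = refl
  sum-cong f g (x ∷ xs) h = cong₂ _+_ (h x (here refl)) (sum-cong f g xs (λ y m → h y (there m)))

  sum-+ : ∀ (f g : A → ℕ) xs → sum (map (λ x → f x + g x) xs) ≡ sum (map f xs) + sum (map g xs)
  sum-+ f g [] = refl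
  sum-+ f g (x ∷ xs) rewrite sum-+ f g xs = interchange (f x) (g x) (sum (map f xs)) (sum (map g xs))
    where interchange : ∀ a b c d → a + b + (c + d) ≡ a + c + (b + d)
          interchange = solve-∀

  sum-* : ∀ (c : ℕ) (f : A → ℕ) xs → sum (map (λ x → c * f x) xs) ≡ c * sum (map f xs)
  sum-* c f [] = sym (NP.*-zeroʳ c)
  sum-* c f (x ∷ xs) rewrite sum-* c f xs = sym (NP.*-distribˡ-+ c (f x) _)

  sum-mono : ∀ (f g : A → ℕ) xs → (∀ x → f x ≤ g x) → sum (map f xs) ≤ sum (map g xs)
  sum-mono f g [] h = z≤n
  sum-mono f g (x ∷ xs) h = NP.+-mono-≤ (h x) (sum-mono f g xs h)

  sum-strict : ∀ (f g : A → ℕ) {xs a} → a ∈ xs → (∀ x → f x ≤ g x) → f a ℕ.< g a →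
               sum (map f xs) ℕ.< sum (map g xs)
  sum-strict f g {x ∷ xs} (here refl) h lt = NP.+-mono-<-≤ lt (sum-mono f g xs h)
  sum-strict f g {x ∷ xs} (there m) h lt = NP.+-mono-≤-< (h x) (sum-strict f g m h lt)

  sum-map-++ : ∀ (f : A → ℕ) xs ys → sum (map f (xs ++ ys)) ≡ sum (map f xs) + sum (map f ys)
  sum-map-++ f xs ys rewrite map-++ f xs ys = sum-++ (map f xs) (map f ys)

  sum-same-members : ∀ (f : A → ℕ) {xs ys} → Unique xs → Unique ys →
                     (∀ {x} → x ∈ xs → x ∈ ys) → (∀ {x} → x ∈ ys → x ∈ xs) →
                     sum (map f xs) ≡ sum (map f ys)
  sum-same-members f ux uy to from =
    sum-↭ (↭P.map⁺ f (∼bag⇒↭ (unique∧set⇒bag ux uy (mk⇔ to from))))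

  sum-vanish : ∀ (f : A → ℕ) {xs} → All (λ x → f x ≡ 0) xs → sum (map f xs) ≡ 0
  sum-vanish f [] = refl
  sum-vanish f (z ∷ zs) rewrite z = sum-vanish f zs

  sum-delta : ∀ (f : A → ℕ) {xs a} → Unique xs → a ∈ xs → (∀ x → x ≢ a → f x ≡ 0) →
              sum (map f xs) ≡ f a
  sum-delta f (distinct ∷ _) (here refl) h =
    trans (cong (f _ +_) (sum-vanish f (All.map (λ ne → h _ (≢-sym ne)) distinct))) (NP.+-identityʳ _)
  sum-delta f (distinct ∷ u) (there m) h =
    cong₂ _+_ (h _ (λ e → All.lookup distinct m e)) (sum-delta f u m h)

  prod-delta : ∀ (f g : A → ℕ) {xs a} → Unique xs → a ∈ xs →
               (∀ x → x ≢ a → f x ≡ g x) → g a ≡ 1 →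
               product (map f xs) ≡ f a * product (map g xs)
  prod-delta f g {a ∷ ys} (distinct ∷ _) (here refl) h ga =
    cong (f a *_) (trans (agree distinct) (sym (trans (cong (_* product (map g ys)) ga) (NP.*-identityˡ _))))
    where agree : ∀ {ys} → All (_ ≢_) ys → product (map f ys) ≡ product (map g ys)
          agree [] = refl
          agree (ne ∷ nes) = cong₂ _*_ (h _ (≢-sym ne)) (agree nes)
  prod-delta f g {x ∷ xs} {a} (distinct ∷ u) (there m) h ga
    rewrite prod-delta f g u m h ga | h x (λ e → All.lookup distinct m e) =
      swap (g x) (f a) (product (map g xs))
    where swap : ∀ p q r → p * (q * r) ≡ q * (p * r)
          swap = solve-∀

  Unique-map-leftInverse : ∀ {b} {B : Set b} (f : A → B) (h : B → A) {xs} → Unique xs →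
                           (∀ x → x ∈ xs → h (f x) ≡ x) → Unique (map f xs)
  Unique-map-leftInverse f h [] _ = []
  Unique-map-leftInverse f h {x ∷ xs} (distinct ∷ u) inv =
    separated xs distinct (λ y m → inv y (there m)) ∷ Unique-map-leftInverse f h u (λ y m → inv y (there m))
    where
      separated : ∀ ys → All (x ≢_) ys → (∀ y → y ∈ ys → h (f y) ≡ y) → All (f x ≢_) (map f ys)
      separated [] _ _ = []
      separated (y ∷ ys) (ne ∷ nes) iv =
        (λ e → ne (trans (sym (inv x (here refl))) (trans (cong h e) (iv y (here refl)))))
        ∷ separated ys nes (λ z m → iv z (there m))

sum-cartesianProduct : ∀ {a b} {A : Set a} {B : Set b} (g : A × B → ℕ) xs ys →
  sum (map g (cartesianProduct xs ys)) ≡ sum (map (λ x → sum (map (λ y → g (x , y)) ys)) xs)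
sum-cartesianProduct g [] ys = refl
sum-cartesianProduct g (x ∷ xs) ys =
  trans (sum-map-++ g (map (x ,_) ys) (cartesianProduct xs ys))
        (cong₂ _+_ (cong sum (sym (map-∘ ys))) (sum-cartesianProduct g xs ys))

T-∧-intro : ∀ {a b} → T a → T b → T (a ∧ b)
T-∧-intro ta tb = Equivalence.from T-∧ (ta , tb)

T-∧-fst : ∀ {a b} → T (a ∧ b) → T a
T-∧-fst {a} {b} t = proj₁ (Equivalence.to (T-∧ {a} {b}) t)

T-∧-snd : ∀ {a b} → T (a ∧ b) → T b
T-∧-snd {a} {b} t = proj₂ (Equivalence.to (T-∧ {a} {b}) t)

T⇒≡true : ∀ {b} → T b → b ≡ true
T⇒≡true = Equivalence.to T-≡

¬T⇒≡false : ∀ {b} → ¬ T b → b ≡ false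
¬T⇒≡false {false} _ = refl
¬T⇒≡false {true} n = ⊥-elim (n tt)

T-not⁻ : ∀ {a} → T (not a) → ¬ T a
T-not⁻ {false} _ ()

exactly-one : ∀ {a b : Bool} → a ≡ not b → (T a × ¬ T b) ⊎ (¬ T a × T b)
exactly-one {true} {false} _ = inj₁ (tt , λ ())
exactly-one {false} {true} _ = inj₂ ((λ ()) , tt)

T-ext : ∀ {a b : Bool} → (T a → T b) → (T b → T a) → a ≡ b
T-ext {false} {false} _ _ = refl
T-ext {false} {true} _ g = ⊥-elim (g tt)
T-ext {true} {false} f _ = ⊥-elim (f tt)
T-ext {true} {true} _ _ = refl

_==_ : ∀ {n} → Fin n → Fin n → Bool
x == y = isYes (x F.≟ y)

==-refl : ∀ {n} (x : Fin n) → (x == x) ≡ true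
==-refl x with x F.≟ x
... | yes _ = refl
... | no x≢x = ⊥-elim (x≢x refl)

==-false : ∀ {n} {x y : Fin n} → x ≢ y → (x == y) ≡ false
==-false {x = x} {y} x≢y with x F.≟ y
... | yes x≡y = ⊥-elim (x≢y x≡y)
... | no _ = refl

<ᵇ-sound : ∀ {a b} → T (a <ᵇ b) → a ℕ.< b
<ᵇ-sound = NP.<ᵇ⇒< _ _

<ᵇ-false : ∀ {a b} → ¬ T (a <ᵇ b) → b ≤ a
<ᵇ-false ¬lt = NP.≮⇒≥ (λ lt → ¬lt (NP.<⇒<ᵇ lt))

_<ᶠ_ : ∀ {n} → Fin n → Fin n → Bool
i <ᶠ j = isYes (i FP.<? j)

<ᶠ-sound : ∀ {n} {i j : Fin n} → T (i <ᶠ j) → i F.< j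
<ᶠ-sound = toWitness

-- Subsets of the vertex set Fin n, as characteristic functions, and their
-- cardinalities.  Restricting graphs to such subsets is what makes the
-- vertex-by-vertex inductions below possible.

Sub : ℕ → Set
Sub n = Fin n → Bool

_─_ : ∀ {n} → Sub n → Fin n → Sub n
(U ─ u) x = U x ∧ not (x == u)

𝟙 : Bool → ℕ
𝟙 b = if b then 1 else 0

count : ∀ {n} → Sub n → ℕ
count {n} P = sum (map (λ x → 𝟙 (P x)) (allFin n))

module _ {n : ℕ} where

  ─-elim : ∀ {U : Sub n} {v x} → T ((U ─ v) x) → T (U x) × x ≢ v
  ─-elim {U = U} {v} {x} t =
    T-∧-fst t , λ { refl → T-not⁻ (T-∧-snd {U x} t) (subst T (sym (==-refl x)) tt) }

  ─-intro : ∀ {U : Sub n} {v x} → T (U x) → x ≢ v → T ((U ─ v) x)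
  ─-intro t x≢v = T-∧-intro t (subst (λ b → T (not b)) (sym (==-false x≢v)) tt)

  ─-comm : ∀ (U : Sub n) u v x → ((U ─ u) ─ v) x ≡ ((U ─ v) ─ u) x
  ─-comm U u v x = T-ext (swap u v) (swap v u)
    where
      swap : ∀ a b → T (((U ─ a) ─ b) x) → T (((U ─ b) ─ a) x)
      swap a b t with ─-elim {U = U ─ a} t
      ... | t' , x≢b with ─-elim {U = U} t'
      ... | ux , x≢a = ─-intro {U = U ─ b} (─-intro {U = U} ux x≢b) x≢a

  count-cong : (P Q : Sub n) → (∀ x → P x ≡ Q x) → count P ≡ count Q
  count-cong P Q h = sum-cong _ _ (allFin n) (λ x _ → cong 𝟙 (h x))

  𝟙-mono : ∀ {a b} → (T a → T b) → 𝟙 a ≤ 𝟙 b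
  𝟙-mono {false} h = z≤n
  𝟙-mono {true} {true} h = s≤s z≤n
  𝟙-mono {true} {false} h = ⊥-elim (h tt)

  count-mono : (P Q : Sub n) → (∀ x → T (P x) → T (Q x)) → count P ≤ count Q
  count-mono P Q h = sum-mono _ _ (allFin n) (λ x → 𝟙-mono (h x))

  count-strict : (P Q : Sub n) → (∀ x → T (P x) → T (Q x)) → ∀ a → T (Q a) → ¬ T (P a) →
                 count P ℕ.< count Q
  count-strict P Q h a qa ¬pa = sum-strict _ _ (∈-allFin a) (λ x → 𝟙-mono (h x))
    (subst₂ (λ u v → 𝟙 u ℕ.< 𝟙 v) (sym (¬T⇒≡false ¬pa)) (sym (T⇒≡true qa)) (s≤s z≤n))

  count-zero : (P : Sub n) → (∀ x → ¬ T (P x)) → count P ≡ 0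
  count-zero P h = sum-vanish _ (AllP.tabulate⁺ (λ x → cong 𝟙 (¬T⇒≡false (h x))))

  count-split : (P Q : Sub n) → count P ≡ count (λ x → P x ∧ Q x) + count (λ x → P x ∧ not (Q x))
  count-split P Q = trans (sum-cong _ _ (allFin n) (λ x _ → split (P x) (Q x)))
                          (sum-+ (λ x → 𝟙 (P x ∧ Q x)) (λ x → 𝟙 (P x ∧ not (Q x))) (allFin n))
    where split : ∀ a b → 𝟙 a ≡ 𝟙 (a ∧ b) + 𝟙 (a ∧ not b)
          split false b = refl
          split true false = refl
          split true true = refl

  count-─ : (P : Sub n) → ∀ a → T (P a) → count P ≡ suc (count (P ─ a))
  count-─ P a pa = trans (count-split P (_== a)) (cong (_+ count (P ─ a)) single)
    where
      single : count (λ x → P x ∧ (x == a)) ≡ 1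
      single = trans (sum-delta _ (UniqueP.allFin⁺ n) (∈-allFin a) off-a)
                     (cong 𝟙 (cong₂ _∧_ (T⇒≡true pa) (==-refl a)))
        where off-a : ∀ x → x ≢ a → 𝟙 (P x ∧ (x == a)) ≡ 0
              off-a x x≢a rewrite ==-false x≢a | ∧-zeroʳ (P x) = refl

  count-≤1 : (P : Sub n) → (∀ x y → T (P x) → T (P y) → x ≡ y) → count P ≤ 1
  count-≤1 P h with FP.any? (λ x → T? (P x))
  ... | yes (a , pa) = NP.≤-reflexive (trans (count-─ P a pa) (cong suc (count-zero _ only-a)))
    where only-a : ∀ x → ¬ T ((P ─ a) x)
          only-a x t = proj₂ (─-elim {U = P} t) (h x a (proj₁ (─-elim {U = P} t)) pa)
  ... | no empty = NP.≤-trans (NP.≤-reflexive (count-zero P (λ x px → empty (x , px)))) z≤n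

  count-pos : (P : Sub n) {k : ℕ} → count P ≡ suc k → Σ (Fin n) λ a → T (P a)
  count-pos P e with FP.any? (λ x → T? (P x))
  ... | yes member = member
  ... | no empty = ⊥-elim (NP.0≢1+n (trans (sym (count-zero P (λ x px → empty (x , px)))) e))

  count-0⇒empty : (P : Sub n) → count P ≡ 0 → ∀ x → ¬ T (P x)
  count-0⇒empty P e x px = NP.0≢1+n (trans (sym e) (count-─ P x px))

  count-∧-all : (Z c : Sub n) → (∀ x → T (Z x) → T (c x)) → count (λ x → Z x ∧ c x) ≡ count Z
  count-∧-all Z c h = count-cong _ _ (λ x → T-ext T-∧-fst (λ zx → T-∧-intro zx (h x zx)))

  count-∧-none : (Z c : Sub n) → (∀ x → T (Z x) → ¬ T (c x)) → count (λ x → Z x ∧ c x) ≡ 0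
  count-∧-none Z c h = count-zero _ (λ x t → h x (T-∧-fst t) (T-∧-snd {Z x} t))

argmax : ∀ {m} (f : Fin (suc m) → ℕ) → Σ (Fin (suc m)) λ t → ∀ s → f s ≤ f t
argmax {zero} f = zero , λ { zero → NP.≤-refl }
argmax {suc m} f with argmax (λ s → f (suc s))
... | t , max with f zero ℕ.≤? f (suc t)
... | yes f0≤ = suc t , λ { zero → f0≤ ; (suc s) → max s }
... | no f0≰ = zero , λ { zero → NP.≤-refl ; (suc s) → NP.≤-trans (max s) (NP.<⇒≤ (NP.≰⇒> f0≰)) }

argmaxOn : ∀ {n} (P : Sub n) (f : Fin n → ℕ) (a : Fin n) → T (P a) →
           Σ (Fin n) λ m → T (P m) × (∀ x → T (P x) → f x ≤ f m)
argmaxOn {suc n} P f a pa with argmax (λ x → if P x then suc (f x) else 0)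
... | m , max with P m in pm
... | true = m , subst T (sym pm) tt ,
             λ x px → NP.≤-pred (subst (λ b → (if b then suc (f x) else 0) ≤ suc (f m)) (T⇒≡true px) (max x))
... | false = ⊥-elim (NP.n≮0 (subst (λ b → (if b then suc (f a) else 0) ≤ 0) (T⇒≡true pa) (max a)))

module _ {n : ℕ} where

  arrow : Orientation n → Fin n → Fin n → Bool
  arrow o i j = lookup (lookup o i) j

  fromArrows : (Fin n → Fin n → Bool) → Orientation n
  fromArrows F = tabulate (λ i → tabulate (F i))

  arrow-fromArrows : ∀ F i j → arrow (fromArrows F) i j ≡ F i j
  arrow-fromArrows F i j rewrite VP.lookup∘tabulate (λ i → tabulate (F i)) i = VP.lookup∘tabulate (F i) j

  orientation-ext : ∀ (o o' : Orientation n) → (∀ i j → arrow o i j ≡ arrow o' i j) → o ≡ o'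
  orientation-ext o o' h = begin
      o                     ≡⟨ sym (VP.tabulate∘lookup o) ⟩
      tabulate (lookup o)   ≡⟨ VP.tabulate-cong row ⟩
      tabulate (lookup o')  ≡⟨ VP.tabulate∘lookup o' ⟩
      o'                    ∎
    where
      open ≡-Reasoning
      row : ∀ i → lookup o i ≡ lookup o' i
      row i = trans (sym (VP.tabulate∘lookup (lookup o i)))
                    (trans (VP.tabulate-cong (h i)) (VP.tabulate∘lookup (lookup o' i)))

  -- A potential strictly increases along every arrow; its existence is the
  -- workable certificate of acyclicity used throughout.
  Potential : Orientation n → Set
  Potential o = Σ (Fin n → ℕ) λ r → ∀ i j → i ⇀[ o ] j → r i ℕ.< r j

  -- along a directed cycle the potential cannot increase at a maximum
  potential⇒acyclic : ∀ {o} → Potential o → ¬ HasDirectedCycle o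
  potential⇒acyclic (r , incr) (m , c , _ , step) with argmax (λ t → r (c t))
  ... | t , max = NP.<⇒≱ (incr _ _ (step t)) (max (next t))

  triangle : ∀ {o} {x y z : Fin n} → x ≢ y → y ≢ z → x ≢ z →
             x ⇀[ o ] y → y ⇀[ o ] z → z ⇀[ o ] x → HasDirectedCycle o
  triangle {o} {x} {y} {z} x≢y y≢z x≢z xy yz zx = 2 , vertex , injective , step
    where
      vertex : Fin 3 → Fin n
      vertex zero = x
      vertex (suc zero) = y
      vertex (suc (suc zero)) = z
      injective : Injective _≡_ _≡_ vertex
      injective {zero} {zero} _ = refl
      injective {zero} {suc zero} e = ⊥-elim (x≢y e)
      injective {zero} {suc (suc zero)} e = ⊥-elim (x≢z e)
      injective {suc zero} {zero} e = ⊥-elim (x≢y (sym e))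
      injective {suc zero} {suc zero} _ = refl
      injective {suc zero} {suc (suc zero)} e = ⊥-elim (y≢z e)
      injective {suc (suc zero)} {zero} e = ⊥-elim (x≢z (sym e))
      injective {suc (suc zero)} {suc zero} e = ⊥-elim (y≢z (sym e))
      injective {suc (suc zero)} {suc (suc zero)} _ = refl
      step : ∀ t → vertex t ⇀[ o ] vertex (next t)
      step zero = xy
      step (suc zero) = yz
      step (suc (suc zero)) = zx

module Graph {n : ℕ} (w : S n) where

  adjB : Fin n → Fin n → Bool
  adjB x y = isYes (adj? w x y)

  adjB-sound : ∀ {x y} → T (adjB x y) → Adj w x y
  adjB-sound {x} {y} t with adj? w x y
  ... | yes a = a

  adjB-complete : ∀ {x y} → Adj w x y → T (adjB x y)
  adjB-complete {x} {y} a with adj? w x y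
  ... | yes _ = tt
  ... | no ¬a = ¬a a

  Adj-sym : ∀ {x y} → Adj w x y → Adj w y x
  Adj-sym (inj₁ p) = inj₂ p
  Adj-sym (inj₂ p) = inj₁ p

  Adj-irrefl : ∀ {x} → ¬ Adj w x x
  Adj-irrefl (inj₁ (x<x , _)) = FP.<-irrefl refl x<x
  Adj-irrefl (inj₂ (x<x , _)) = FP.<-irrefl refl x<x

  Adj-≢ : ∀ {x y} → Adj w x y → x ≢ y
  Adj-≢ a refl = Adj-irrefl a

  deg : Sub n → Fin n → ℕ
  deg U x = count (λ y → U y ∧ adjB x y)

  Edge : Sub n → Fin n → Fin n → Set
  Edge U i j = T (U i) × T (U j) × Adj w i j

  edge? : ∀ U i j → Dec (Edge U i j)
  edge? U i j = T? (U i) ×-dec (T? (U j) ×-dec adj? w i j)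

  record OrientsOn (U : Sub n) (o : Orientation n) : Set where
    constructor orients
    field
      on-edges : ∀ i j → Edge U i j → (i ⇀[ o ] j × ¬ (j ⇀[ o ] i)) ⊎ (¬ (i ⇀[ o ] j) × j ⇀[ o ] i)
      off-edges : ∀ i j → ¬ Edge U i j → ¬ (i ⇀[ o ] j)

  module _ {U : Sub n} {o : Orientation n} (oo : OrientsOn U o) where
    open OrientsOn oo

    arrow⇒edge : ∀ {i j} → i ⇀[ o ] j → Edge U i j
    arrow⇒edge {i} {j} a with edge? U i j
    ... | yes e = e
    ... | no ¬e = ⊥-elim (off-edges i j ¬e a)

    arrow-asym : ∀ {i j} → i ⇀[ o ] j → ¬ (j ⇀[ o ] i)
    arrow-asym {i} {j} a with on-edges i j (arrow⇒edge a)
    ... | inj₁ (_ , ¬ji) = ¬ji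
    ... | inj₂ (¬ij , _) = ⊥-elim (¬ij a)

    arrow-irrefl : ∀ {i} → ¬ (i ⇀[ o ] i)
    arrow-irrefl a = Adj-irrefl (proj₂ (proj₂ (arrow⇒edge a)))

    edge⇒arrow : ∀ {i j} → Edge U i j → (i ⇀[ o ] j) ⊎ (j ⇀[ o ] i)
    edge⇒arrow {i} {j} e with on-edges i j e
    ... | inj₁ (a , _) = inj₁ a
    ... | inj₂ (_ , a) = inj₂ a

  Acyclic : Sub n → Orientation n → Set
  Acyclic U o = OrientsOn U o × ¬ HasDirectedCycle o

  Enumerates : Sub n → List (Orientation n) → Set
  Enumerates U L = Unique L × (∀ o → o ∈ L → Acyclic U o) × (∀ o → Acyclic U o → o ∈ L)

  Acyclic-cong : ∀ {U U'} → (∀ x → U x ≡ U' x) → ∀ {o} → Acyclic U o → Acyclic U' o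
  Acyclic-cong {U} {U'} U≡U' {o} (oo , acyclic) = oo' , acyclic
    where
      back : ∀ {i j} → Edge U' i j → Edge U i j
      back {i} {j} (ui , uj , a) = subst T (sym (U≡U' i)) ui , subst T (sym (U≡U' j)) uj , a
      forth : ∀ {i j} → Edge U i j → Edge U' i j
      forth {i} {j} (ui , uj , a) = subst T (U≡U' i) ui , subst T (U≡U' j) uj , a
      open OrientsOn oo
      oo' : OrientsOn U' o
      oo' = orients (λ i j e → on-edges i j (back e)) (λ i j ¬e → off-edges i j (λ e → ¬e (forth e)))

  enumeration-unique : ∀ {U U' L L'} → (∀ x → U x ≡ U' x) → Enumerates U L → Enumerates U' L' →
                       ∀ q → R-via L q ≡ R-via L' q
  enumeration-unique U≡U' (uL , soundL , completeL) (uL' , soundL' , completeL') q =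
    sum-same-members (λ o → q ^ des o) uL uL'
      (λ {o} m → completeL' o (Acyclic-cong U≡U' {o = o} (soundL o m)))
      (λ {o} m → completeL o (Acyclic-cong (λ x → sym (U≡U' x)) {o = o} (soundL' o m)))

  Simplicial : Sub n → Fin n → Set
  Simplicial U u = T (U u) ×
    (∀ x y → T (U x) → T (U y) → Adj w u x → Adj w u y → x ≢ y → Adj w x y)

  OneSided : Sub n → Fin n → Set
  OneSided U u = (∀ x → T (U x) → Adj w u x → u F.< x) ⊎ (∀ x → T (U x) → Adj w u x → x F.< u)

  Nice : Sub n → Fin n → Set
  Nice U u = Simplicial U u × OneSided U u

  Simplicial-sub : ∀ {U V u} → (∀ x → T (V x) → T (U x)) → T (V u) → Simplicial U u → Simplicial V u
  Simplicial-sub V⊆U vu (_ , clique) = vu , λ x y vx vy → clique x y (V⊆U x vx) (V⊆U y vy)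

  OneSided-sub : ∀ {U V u} → (∀ x → T (V x) → T (U x)) → OneSided U u → OneSided V u
  OneSided-sub V⊆U (inj₁ above) = inj₁ (λ x vx → above x (V⊆U x vx))
  OneSided-sub V⊆U (inj₂ below) = inj₂ (λ x vx → below x (V⊆U x vx))

  Nice-sub : ∀ {U V u} → (∀ x → T (V x) → T (U x)) → T (V u) → Nice U u → Nice V u
  Nice-sub V⊆U vu (simp , side) = Simplicial-sub V⊆U vu simp , OneSided-sub V⊆U side

  deg-─-nonadjacent : ∀ U x y → ¬ Adj w x y → deg (U ─ y) x ≡ deg U x
  deg-─-nonadjacent U x y ¬a = count-cong _ _ λ z → T-ext
    (λ t → T-∧-intro (proj₁ (─-elim {U = U} (T-∧-fst t))) (T-∧-snd {(U ─ y) z} t))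
    (λ t → T-∧-intro (─-intro {U = U} (T-∧-fst t) (λ { refl → ¬a (adjB-sound (T-∧-snd {U z} t)) }))
                     (T-∧-snd {U z} t))

  deg-─-adjacent : ∀ U x y → T (U y) → Adj w x y → deg U x ≡ suc (deg (U ─ y) x)
  deg-─-adjacent U x y uy a = trans (count-─ _ y (T-∧-intro uy (adjB-complete a)))
    (cong suc (count-cong _ _ λ z → T-ext
      (λ t → let (t₁ , z≢y) = ─-elim {U = λ z → U z ∧ adjB x z} t
             in T-∧-intro (─-intro {U = U} (T-∧-fst t₁) z≢y) (T-∧-snd {U z} t₁))
      (λ t → let (uz , z≢y) = ─-elim {U = U} (T-∧-fst t)
             in ─-intro {U = λ z → U z ∧ adjB x z} (T-∧-intro uz (T-∧-snd {(U ─ y) z} t)) z≢y)))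

  -- two adjacent simplicial vertices have the same neighbours apart from each other
  deg-─-simplicial : ∀ U u v → Simplicial U u → Simplicial U v → Adj w u v →
                     deg (U ─ v) u ≡ deg (U ─ u) v
  deg-─-simplicial U u v su sv auv = count-cong _ _ λ z → T-ext (transfer su sv auv {z}) (transfer sv su (Adj-sym auv) {z})
    where
      transfer : ∀ {a b} → Simplicial U a → Simplicial U b → Adj w a b →
                 ∀ {z} → T ((U ─ b) z ∧ adjB a z) → T ((U ─ a) z ∧ adjB b z)
      transfer {a} {b} sa sb aab {z} t with ─-elim {U = U} (T-∧-fst t)
      ... | uz , z≢b = T-∧-intro (─-intro {U = U} uz (λ e → Adj-≢ aaz (sym e)))
                                 (adjB-complete (Adj-sym (proj₂ sa z b uz (proj₁ sb) aaz aab z≢b)))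
        where aaz = adjB-sound (T-∧-snd {(U ─ b) z} t)

  deletion-factors-commute : ∀ U u v → Simplicial U u → Simplicial U v → ∀ q X →
    [ deg U u + 1 ] q * ([ deg (U ─ u) v + 1 ] q * X) ≡ [ deg U v + 1 ] q * ([ deg (U ─ v) u + 1 ] q * X)
  deletion-factors-commute U u v su sv q X with adj? w u v
  ... | yes a rewrite deg-─-adjacent U u v (proj₁ sv) a | deg-─-adjacent U v u (proj₁ su) (Adj-sym a)
                    | deg-─-simplicial U u v su sv a = refl
  ... | no ¬a rewrite deg-─-nonadjacent U u v ¬a | deg-─-nonadjacent U v u (λ a → ¬a (Adj-sym a)) =
        swap ([ deg U u + 1 ] q) ([ deg U v + 1 ] q) X
    where swap : ∀ a b c → a * (b * c) ≡ b * (a * c)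
          swap = solve-∀

  whole : Sub n
  whole _ = true

  acyclic-whole : ∀ o → IsAcyclicOrientation w o ⇔ Acyclic whole o
  acyclic-whole o = mk⇔ (λ (io , acyclic) → orients (λ i j e → proj₁ (io i j) (proj₂ (proj₂ e)))
                                                    (λ i j ¬e → proj₂ (io i j) (λ a → ¬e (tt , tt , a))) , acyclic)
                        (λ (oo , acyclic) → (λ i j → OrientsOn.on-edges oo i j ∘ (λ a → tt , tt , a) ,
                                                     (λ ¬a → OrientsOn.off-edges oo i j (¬a ∘ proj₂ ∘ proj₂))) , acyclic)

  enumerates-whole : ∀ L → EnumeratesAcyclicOrientations w L ⇔ Enumerates whole L
  enumerates-whole L = mk⇔
    (λ (unique , members) → unique , (λ o m → to (acyclic-whole o) (to (members o) m)) ,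
                                     (λ o a → from (members o) (from (acyclic-whole o) a)))
    (λ (unique , sound , complete) → unique , λ o → mk⇔ (from (acyclic-whole o) ∘ sound o) (complete o ∘ to (acyclic-whole o)))
    where open Equivalence

module _ {n : ℕ} where

  -- The new
  -- potential is 2r+1 off u and 2M at u, where M bounds r+1 on in-neighbours.
  potential-extend : ∀ (o : Orientation n) (u : Fin n) (r : Fin n → ℕ) →
    (∀ i j → i ≢ u → j ≢ u → i ⇀[ o ] j → r i ℕ.< r j) →
    (∀ x y → x ⇀[ o ] u → u ⇀[ o ] y → r x ℕ.< r y) →
    ¬ (u ⇀[ o ] u) → Potential o
  potential-extend o u r off-u through-u no-loop = r' , increasing
    where
      inBound : Fin n → ℕ
      inBound x = if arrow o x u then suc (r x) else 0
      M : ℕ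
      M = max 0 (map inBound (allFin n))
      r' : Fin n → ℕ
      r' i = if i == u then 2 * M else suc (2 * r i)
      in<M : ∀ {x} → x ⇀[ o ] u → suc (r x) ≤ M
      in<M {x} xu = subst (_≤ M) (cong (λ b → if b then suc (r x) else 0) (T⇒≡true xu))
        (All.lookup (AllP.map⁻ (xs≤max 0 (map inBound (allFin n)))) (∈-allFin x))
      M≤out : ∀ {y} → u ⇀[ o ] y → M ≤ r y
      M≤out {y} uy = max≤v⁺ z≤n (AllP.map⁺ (AllP.tabulate⁺ bound))
        where bound : ∀ x → inBound x ≤ r y
              bound x with arrow o x u in xu
              ... | true = through-u x y (subst T (sym xu) _) uy
              ... | false = z≤n
      increasing : ∀ i j → i ⇀[ o ] j → r' i ℕ.< r' j
      increasing i j a with i F.≟ u | j F.≟ u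
      ... | yes refl | yes refl = ⊥-elim (no-loop a)
      ... | yes refl | no j≢u = s≤s (NP.*-monoʳ-≤ 2 (M≤out a))
      ... | no i≢u | yes refl = NP.≤-trans (NP.≤-reflexive (sym (NP.*-suc 2 (r i)))) (NP.*-monoʳ-≤ 2 (in<M a))
      ... | no i≢u | no j≢u = s≤s (NP.*-monoʳ-< 2 (off-u i j i≢u j≢u a))

  -- Σ_{j<i} g i j; by definition des o is this sum for the arrow indicator
  descentSum : (Fin n → Fin n → ℕ) → ℕ
  descentSum g = sum (map (λ i → sum (map (λ j → if j <ᶠ i then g i j else 0) (allFin n))) (allFin n))

  descentSum-+ : ∀ g g₁ g₂ → (∀ i j → g i j ≡ g₁ i j + g₂ i j) →
                 descentSum g ≡ descentSum g₁ + descentSum g₂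
  descentSum-+ g g₁ g₂ split =
    trans (sum-cong _ _ (allFin n) (λ i _ →
             trans (sum-cong _ _ (allFin n) (λ j _ → split-if (j <ᶠ i) (split i j)))
                   (sum-+ _ _ (allFin n))))
          (sum-+ _ _ (allFin n))
    where split-if : ∀ b {x y z} → x ≡ y + z → (if b then x else 0) ≡ (if b then y else 0) + (if b then z else 0)
          split-if true e = e
          split-if false _ = refl

  descentSum-zero : ∀ g → (∀ i j → g i j ≡ 0) → descentSum g ≡ 0
  descentSum-zero g zero-g = sum-vanish _ (AllP.tabulate⁺ λ i → sum-vanish _ (AllP.tabulate⁺ λ j → vanish (j <ᶠ i) (zero-g i j)))
    where vanish : ∀ b {x} → x ≡ 0 → (if b then x else 0) ≡ 0
          vanish true e = e
          vanish false _ = refl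

  private
    if-𝟙 : ∀ b c → (if b then 𝟙 c else 0) ≡ 𝟙 (c ∧ b)
    if-𝟙 b false = if-zero b
      where if-zero : ∀ b → (if b then 0 else 0) ≡ 0
            if-zero true = refl
            if-zero false = refl
    if-𝟙 true true = refl
    if-𝟙 false true = refl

    at-u : ∀ (f : Fin n → ℕ) (u : Fin n) → (∀ x → x ≢ u → f x ≡ 0) → sum (map f (allFin n)) ≡ f u
    at-u f u = sum-delta f (UniqueP.allFin⁺ n) (∈-allFin u)

  descentSum-row : ∀ (u : Fin n) (X : Sub n) →
                   descentSum (λ i j → 𝟙 ((i == u) ∧ X j)) ≡ count (λ j → X j ∧ (j <ᶠ u))
  descentSum-row u X = trans (at-u _ u other-rows)
                             (sum-cong _ _ (allFin n) (λ j _ → trans (cong (λ b → if j <ᶠ u then 𝟙 (b ∧ X j) else 0) (==-refl u))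
                                                                     (if-𝟙 (j <ᶠ u) (X j))))
    where
      other-rows : ∀ i → i ≢ u → sum (map (λ j → if j <ᶠ i then 𝟙 ((i == u) ∧ X j) else 0) (allFin n)) ≡ 0
      other-rows i i≢u rewrite ==-false i≢u = sum-vanish _ (AllP.tabulate⁺ (λ j → if-𝟙 (j <ᶠ i) false))

  descentSum-column : ∀ (u : Fin n) (Y : Sub n) →
                      descentSum (λ i j → 𝟙 ((j == u) ∧ Y i)) ≡ count (λ i → Y i ∧ (u <ᶠ i))
  descentSum-column u Y = sum-cong _ _ (allFin n) (λ i _ → trans (at-u _ u (other-columns i))
    (trans (cong (λ b → if u <ᶠ i then 𝟙 (b ∧ Y i) else 0) (==-refl u)) (if-𝟙 (u <ᶠ i) (Y i))))
    where
      other-columns : ∀ i j → j ≢ u → (if j <ᶠ i then 𝟙 ((j == u) ∧ Y i) else 0) ≡ 0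
      other-columns i j j≢u rewrite ==-false j≢u = if-𝟙 (j <ᶠ i) false

-- An acyclic orientation of G[U] is
-- the same as an acyclic orientation o of G[U ─ u] together with a cut of
-- the neighbourhood K of u, which o orders linearly as K is a clique: the
-- vertices of K below the cut point to u, the others are pointed to by u.
-- As all of K lies on one side of u, the cut at height p creates p descents.
module Extension {n : ℕ} (w : S n) (U : Sub n) (u : Fin n) (nice : Graph.Nice w U u) where
  open Graph w

  U' : Sub n
  U' = U ─ u

  K : Sub n
  K x = U x ∧ adjB u x

  d : ℕ
  d = count K

  u∈U : T (U u)
  u∈U = proj₁ (proj₁ nice)

  K⊆U : ∀ {x} → T (K x) → T (U x)
  K⊆U = T-∧-fst

  K-adj : ∀ {x} → T (K x) → Adj w u x
  K-adj {x} t = adjB-sound (T-∧-snd {U x} t)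

  K-intro : ∀ {x} → T (U x) → Adj w u x → T (K x)
  K-intro ux a = T-∧-intro ux (adjB-complete a)

  K-≢u : ∀ {x} → T (K x) → x ≢ u
  K-≢u kx refl = Adj-irrefl (K-adj kx)

  K⊆U' : ∀ {x} → T (K x) → T (U' x)
  K⊆U' kx = ─-intro {U = U} (K⊆U kx) (K-≢u kx)

  u∉U' : ¬ T (U' u)
  u∉U' t = proj₂ (─-elim {U = U} t) refl

  K-u≡false : K u ≡ false
  K-u≡false = ¬T⇒≡false (λ ku → K-≢u ku refl)

  K-edge : ∀ {x y} → T (K x) → T (K y) → x ≢ y → Edge U' x y
  K-edge kx ky x≢y = K⊆U' kx , K⊆U' ky , proj₂ (proj₁ nice) _ _ (K⊆U kx) (K⊆U ky) (K-adj kx) (K-adj ky) x≢y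

  no-arrow-from-u : ∀ {o} → OrientsOn U' o → ∀ j → ¬ (u ⇀[ o ] j)
  no-arrow-from-u oo j a = u∉U' (proj₁ (arrow⇒edge oo a))

  no-arrow-to-u : ∀ {o} → OrientsOn U' o → ∀ i → ¬ (i ⇀[ o ] u)
  no-arrow-to-u oo i a = u∉U' (proj₁ (proj₂ (arrow⇒edge oo a)))

  -- An acyclic orientation o of G[U ─ u] is transitive on the clique K, so
  -- the number of vertices of K pointing to x ranks K linearly.
  rank : Orientation n → Fin n → ℕ
  rank o x = count (λ y → K y ∧ arrow o y x)

  module Ranks (o : Orientation n) (acyclic : Acyclic U' o) where

    private
      oo = proj₁ acyclic

    rank-increasing : ∀ {x y} → T (K x) → T (K y) → x ⇀[ o ] y → rank o x ℕ.< rank o y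
    rank-increasing {x} {y} kx ky xy =
      count-strict _ _ transitive x (T-∧-intro kx xy) (λ t → arrow-irrefl oo (T-∧-snd {K x} t))
      where
        transitive : ∀ z → T (K z ∧ arrow o z x) → T (K z ∧ arrow o z y)
        transitive z t with T-∧-fst {K z} t | T-∧-snd {K z} t
        ... | kz | zx with z F.≟ y
        ... | yes refl = ⊥-elim (arrow-asym oo xy zx)
        ... | no z≢y with edge⇒arrow oo (K-edge kz ky z≢y)
        ... | inj₁ zy = T-∧-intro kz zy
        ... | inj₂ yz = ⊥-elim (proj₂ acyclic (triangle {o = o}
                          (Adj-≢ (proj₂ (proj₂ (arrow⇒edge oo zx)))) (Adj-≢ (proj₂ (proj₂ (arrow⇒edge oo xy))))
                          z≢y zx xy yz))

    rank-injective : ∀ {x y} → T (K x) → T (K y) → rank o x ≡ rank o y → x ≡ y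
    rank-injective {x} {y} kx ky e with x F.≟ y
    ... | yes x≡y = x≡y
    ... | no x≢y with edge⇒arrow oo (K-edge kx ky x≢y)
    ... | inj₁ xy = ⊥-elim (NP.<⇒≢ (rank-increasing kx ky xy) e)
    ... | inj₂ yx = ⊥-elim (NP.<⇒≢ (rank-increasing ky kx yx) (sym e))

    rank<d : ∀ {x} → T (K x) → rank o x ℕ.< d
    rank<d {x} kx = count-strict _ K (λ _ → T-∧-fst) x kx (λ t → arrow-irrefl oo (T-∧-snd {K x} t))

    countBelow : ℕ → ℕ
    countBelow p = count (λ x → K x ∧ (rank o x <ᵇ p))

    -- at most one vertex of K has rank p
    countBelow-suc : ∀ p → countBelow (suc p) ≤ suc (countBelow p)
    countBelow-suc p = begin
        countBelow (suc p)
          ≡⟨ count-split (λ x → K x ∧ (rank o x <ᵇ suc p)) (λ x → rank o x <ᵇ p) ⟩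
        count (λ x → (K x ∧ (rank o x <ᵇ suc p)) ∧ (rank o x <ᵇ p)) +
        count (λ x → (K x ∧ (rank o x <ᵇ suc p)) ∧ not (rank o x <ᵇ p))
          ≤⟨ NP.+-mono-≤ (count-mono _ _ (λ x t → T-∧-intro (T-∧-fst (T-∧-fst t)) (T-∧-snd {K x ∧ _} t)))
                         (count-≤1 _ at-most-one) ⟩
        countBelow p + 1
          ≡⟨ NP.+-comm (countBelow p) 1 ⟩
        suc (countBelow p) ∎
      where
        open NP.≤-Reasoning
        of-rank-p : ∀ x → T ((K x ∧ (rank o x <ᵇ suc p)) ∧ not (rank o x <ᵇ p)) → rank o x ≡ p
        of-rank-p x t = NP.≤-antisym (NP.≤-pred (<ᵇ-sound (T-∧-snd {K x} (T-∧-fst t))))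
                                     (<ᵇ-false (T-not⁻ (T-∧-snd {K x ∧ _} t)))
        at-most-one : ∀ x y → T ((K x ∧ (rank o x <ᵇ suc p)) ∧ not (rank o x <ᵇ p)) →
                              T ((K y ∧ (rank o y <ᵇ suc p)) ∧ not (rank o y <ᵇ p)) → x ≡ y
        at-most-one x y tx ty = rank-injective (T-∧-fst (T-∧-fst tx)) (T-∧-fst (T-∧-fst ty))
                                               (trans (of-rank-p x tx) (sym (of-rank-p y ty)))

    countBelow-+ : ∀ p k → countBelow (k + p) ≤ k + countBelow p
    countBelow-+ p zero = NP.≤-refl
    countBelow-+ p (suc k) = NP.≤-trans (countBelow-suc (k + p)) (s≤s (countBelow-+ p k))

    countBelow-≤ : ∀ p → countBelow p ≤ p
    countBelow-≤ zero = NP.≤-reflexive (count-zero _ (λ x t → NP.n≮0 (<ᵇ-sound {rank o x} {0} (T-∧-snd {K x} t))))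
    countBelow-≤ (suc p) = NP.≤-trans (countBelow-suc p) (s≤s (countBelow-≤ p))

    -- countBelow starts at 0, grows by at most one per step and reaches d at
    -- d, so it is the identity on 0, …, d: the ranks of K are 0, 1, …, d-1
    countBelow-exact : ∀ p → p ≤ d → countBelow p ≡ p
    countBelow-exact p p≤d = NP.≤-antisym (countBelow-≤ p) (NP.+-cancelˡ-≤ (d ∸ p) p (countBelow p) shifted)
      where
        open NP.≤-Reasoning
        shifted : d ∸ p + p ≤ d ∸ p + countBelow p
        shifted = begin
          d ∸ p + p               ≡⟨ NP.m∸n+n≡m p≤d ⟩
          d                       ≤⟨ count-mono K _ (λ x kx → T-∧-intro kx (NP.<⇒<ᵇ (rank<d kx))) ⟩
          countBelow d            ≡⟨ cong countBelow (sym (NP.m∸n+n≡m p≤d)) ⟩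
          countBelow (d ∸ p + p)  ≤⟨ countBelow-+ p (d ∸ p) ⟩
          d ∸ p + countBelow p    ∎

  -- The extension of o cut at parameter p.  The cut height is p if K lies
  -- above u and d ∸ p if K lies below u; in both cases it creates p descents.
  threshold : OneSided U u → ℕ → ℕ
  threshold (inj₁ _) p = p
  threshold (inj₂ _) p = d ∸ p

  cutBelow cutAbove : OneSided U u → Orientation n → ℕ → Sub n
  cutBelow s o p x = K x ∧ (rank o x <ᵇ threshold s p)
  cutAbove s o p x = K x ∧ not (rank o x <ᵇ threshold s p)

  extendArrow : OneSided U u → Orientation n → ℕ → Fin n → Fin n → Bool
  extendArrow s o p i j = if i == u then cutAbove s o p j else if j == u then cutBelow s o p i else arrow o i j

  extend : OneSided U u → Orientation n → ℕ → Orientation n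
  extend s o p = fromArrows (extendArrow s o p)

  module _ (s : OneSided U u) (o : Orientation n) (p : ℕ) where

    extend-from-u : ∀ j → arrow (extend s o p) u j ≡ cutAbove s o p j
    extend-from-u j rewrite arrow-fromArrows (extendArrow s o p) u j | ==-refl u = refl

    extend-to-u : ∀ i → arrow (extend s o p) i u ≡ cutBelow s o p i
    extend-to-u i rewrite arrow-fromArrows (extendArrow s o p) i u with i F.≟ u
    ... | yes refl rewrite K-u≡false = refl
    ... | no i≢u rewrite ==-refl u = refl

    extend-off-u : ∀ i j → i ≢ u → j ≢ u → arrow (extend s o p) i j ≡ arrow o i j
    extend-off-u i j i≢u j≢u rewrite arrow-fromArrows (extendArrow s o p) i j | ==-false i≢u | ==-false j≢u = refl

    extend-at-u : ∀ {x} → T (K x) → arrow (extend s o p) u x ≡ not (arrow (extend s o p) x u)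
    extend-at-u {x} kx rewrite extend-from-u x | extend-to-u x | T⇒≡true kx = refl

  extend-orients : ∀ s o p → OrientsOn U' o → OrientsOn U (extend s o p)
  extend-orients s o p oo = orients on-edges off-edges
    where
      ext = extend s o p
      on-edges : ∀ i j → Edge U i j → (i ⇀[ ext ] j × ¬ (j ⇀[ ext ] i)) ⊎ (¬ (i ⇀[ ext ] j) × j ⇀[ ext ] i)
      on-edges i j (ui , uj , a) with i F.≟ u | j F.≟ u
      ... | yes refl | _ = exactly-one (extend-at-u s o p (K-intro uj a))
      ... | no i≢u | yes refl =
            exactly-one (trans (sym (not-involutive _)) (cong not (sym (extend-at-u s o p (K-intro ui (Adj-sym a))))))
      ... | no i≢u | no j≢u
            rewrite extend-off-u s o p i j i≢u j≢u | extend-off-u s o p j i j≢u i≢u =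
            OrientsOn.on-edges oo i j (─-intro {U = U} ui i≢u , ─-intro {U = U} uj j≢u , a)
      off-edges : ∀ i j → ¬ Edge U i j → ¬ (i ⇀[ ext ] j)
      off-edges i j ¬e a with i F.≟ u | j F.≟ u
      ... | yes refl | _ = ¬e (u∈U , K⊆U kj , K-adj kj)
        where kj = T-∧-fst {K j} (subst T (extend-from-u s o p j) a)
      ... | no i≢u | yes refl = ¬e (K⊆U ki , u∈U , Adj-sym (K-adj ki))
        where ki = T-∧-fst {K i} (subst T (extend-to-u s o p i) a)
      ... | no i≢u | no j≢u with arrow⇒edge oo (subst T (extend-off-u s o p i j i≢u j≢u) a)
      ... | u'i , u'j , aij = ¬e (T-∧-fst u'i , T-∧-fst u'j , aij)

  -- an in-neighbour of u lies below an out-neighbour in the rank order,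
  -- hence points to it; so a potential of o extends to the extension
  extend-potential : ∀ s o p → Acyclic U' o → Potential o → Potential (extend s o p)
  extend-potential s o p acyclic (r , increasing) = potential-extend (extend s o p) u r off-u through-u no-loop
    where
      open Ranks o acyclic
      no-loop : ¬ (u ⇀[ extend s o p ] u)
      no-loop t = subst T K-u≡false (T-∧-fst (subst T (extend-from-u s o p u) t))
      off-u : ∀ i j → i ≢ u → j ≢ u → i ⇀[ extend s o p ] j → r i ℕ.< r j
      off-u i j i≢u j≢u a = increasing i j (subst T (extend-off-u s o p i j i≢u j≢u) a)
      through-u : ∀ x y → x ⇀[ extend s o p ] u → u ⇀[ extend s o p ] y → r x ℕ.< r y
      through-u x y xu uy =
        [ increasing x y , (λ yx → ⊥-elim (NP.<⇒≯ rx<ry (rank-increasing ky kx yx))) ]′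
          (edge⇒arrow (proj₁ acyclic) (K-edge kx ky x≢y))
        where
          below = subst T (extend-to-u s o p x) xu
          above = subst T (extend-from-u s o p y) uy
          kx = T-∧-fst {K x} below
          ky = T-∧-fst {K y} above
          rx<ry : rank o x ℕ.< rank o y
          rx<ry = NP.<-≤-trans (<ᵇ-sound {rank o x} {threshold s p} (T-∧-snd {K x} below))
                               (<ᵇ-false {rank o y} (T-not⁻ (T-∧-snd {K y} above)))
          x≢y : x ≢ y
          x≢y refl = NP.<-irrefl refl rx<ry

  restrict : Orientation n → Orientation n
  restrict o = fromArrows (λ i j → arrow o i j ∧ (not (i == u) ∧ not (j == u)))

  module _ (o : Orientation n) where

    private
      restrict-arrow : ∀ i j → arrow (restrict o) i j ≡ arrow o i j ∧ (not (i == u) ∧ not (j == u))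
      restrict-arrow = arrow-fromArrows (λ i j → arrow o i j ∧ (not (i == u) ∧ not (j == u)))

    restrict-off-u : ∀ i j → i ≢ u → j ≢ u → arrow (restrict o) i j ≡ arrow o i j
    restrict-off-u i j i≢u j≢u rewrite restrict-arrow i j | ==-false i≢u | ==-false j≢u = ∧-identityʳ _

    restrict-from-u : ∀ j → ¬ T (arrow (restrict o) u j)
    restrict-from-u j t rewrite restrict-arrow u j | ==-refl u = subst T (∧-zeroʳ _) t

    restrict-to-u : ∀ i → ¬ T (arrow (restrict o) i u)
    restrict-to-u i t rewrite restrict-arrow i u | ==-refl u | ∧-zeroʳ (not (i == u)) = subst T (∧-zeroʳ _) t

    restrict-⊆ : ∀ i j → i ⇀[ restrict o ] j → i ⇀[ o ] j
    restrict-⊆ i j t with i F.≟ u | j F.≟ u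
    ... | yes refl | _ = ⊥-elim (restrict-from-u j t)
    ... | no _ | yes refl = ⊥-elim (restrict-to-u i t)
    ... | no i≢u | no j≢u = subst T (restrict-off-u i j i≢u j≢u) t

  restrict-acyclic : ∀ o → Acyclic U o → Acyclic U' (restrict o)
  restrict-acyclic o (oo , acyclic) = orients on-edges off-edges , acyclic'
    where
      acyclic' : ¬ HasDirectedCycle (restrict o)
      acyclic' (m , c , injective , step) = acyclic (m , c , injective , λ t → restrict-⊆ o _ _ (step t))
      on-edges : ∀ i j → Edge U' i j →
                 (i ⇀[ restrict o ] j × ¬ (j ⇀[ restrict o ] i)) ⊎ (¬ (i ⇀[ restrict o ] j) × j ⇀[ restrict o ] i)
      on-edges i j (u'i , u'j , a)
        rewrite restrict-off-u o i j (proj₂ (─-elim {U = U} u'i)) (proj₂ (─-elim {U = U} u'j))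
              | restrict-off-u o j i (proj₂ (─-elim {U = U} u'j)) (proj₂ (─-elim {U = U} u'i)) =
        OrientsOn.on-edges oo i j (T-∧-fst u'i , T-∧-fst u'j , a)
      off-edges : ∀ i j → ¬ Edge U' i j → ¬ (i ⇀[ restrict o ] j)
      off-edges i j ¬e t with i F.≟ u | j F.≟ u
      ... | yes refl | _ = restrict-from-u o j t
      ... | no _ | yes refl = restrict-to-u o i t
      ... | no i≢u | no j≢u with arrow⇒edge oo (restrict-⊆ o i j t)
      ... | ui , uj , a = ¬e (T-∧-intro ui tt , T-∧-intro uj tt , a)

  -- u being simplicial, an in-neighbour and an out-neighbour of u are
  -- adjacent, and acyclicity forces the arrow from the former to the latter;
  -- so a potential of the restriction extends to o
  potential-from-restriction : ∀ o → Acyclic U o → Potential (restrict o) → Potential o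
  potential-from-restriction o (oo , acyclic) (r , increasing) =
    potential-extend o u r off-u through-u (arrow-irrefl oo)
    where
      off-u : ∀ i j → i ≢ u → j ≢ u → i ⇀[ o ] j → r i ℕ.< r j
      off-u i j i≢u j≢u a = increasing i j (subst T (sym (restrict-off-u o i j i≢u j≢u)) a)
      through-u : ∀ x y → x ⇀[ o ] u → u ⇀[ o ] y → r x ℕ.< r y
      through-u x y xu uy with arrow⇒edge oo xu | arrow⇒edge oo uy | x F.≟ y
      ... | _ | _ | yes refl = ⊥-elim (arrow-asym oo xu uy)
      ... | ux , _ , axu | _ , uy' , auy | no x≢y
        with edge⇒arrow oo (ux , uy' , proj₂ (proj₁ nice) x y ux uy' (Adj-sym axu) auy x≢y)
      ... | inj₁ xy = off-u x y (Adj-≢ axu) (≢-sym (Adj-≢ auy)) xy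
      ... | inj₂ yx = ⊥-elim (acyclic (triangle {o = o} (Adj-≢ axu) (Adj-≢ auy) x≢y xu uy yx))

  restrict-extend : ∀ s o p → OrientsOn U' o → restrict (extend s o p) ≡ o
  restrict-extend s o p oo = orientation-ext _ _ same
    where
      same : ∀ i j → arrow (restrict (extend s o p)) i j ≡ arrow o i j
      same i j with i F.≟ u | j F.≟ u
      ... | yes refl | _ = trans (¬T⇒≡false (restrict-from-u (extend s o p) j)) (sym (¬T⇒≡false (no-arrow-from-u oo j)))
      ... | no _ | yes refl = trans (¬T⇒≡false (restrict-to-u (extend s o p) i)) (sym (¬T⇒≡false (no-arrow-to-u oo i)))
      ... | no i≢u | no j≢u = trans (restrict-off-u (extend s o p) i j i≢u j≢u) (extend-off-u s o p i j i≢u j≢u)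

  indegree : Orientation n → ℕ
  indegree o = count (λ x → arrow o x u)

  parameter : OneSided U u → Orientation n → ℕ
  parameter (inj₁ _) o = indegree o
  parameter (inj₂ _) o = d ∸ indegree o

  threshold-≤ : ∀ s p → p ≤ d → threshold s p ≤ d
  threshold-≤ (inj₁ _) p p≤d = p≤d
  threshold-≤ (inj₂ _) p _ = NP.m∸n≤m d p

  cutBelow-size : ∀ s o p → Acyclic U' o → p ≤ d → count (cutBelow s o p) ≡ threshold s p
  cutBelow-size s o p acyclic p≤d = Ranks.countBelow-exact o acyclic (threshold s p) (threshold-≤ s p p≤d)

  indegree-extend : ∀ s o p → Acyclic U' o → p ≤ d → indegree (extend s o p) ≡ threshold s p
  indegree-extend s o p acyclic p≤d = trans (count-cong _ _ (extend-to-u s o p)) (cutBelow-size s o p acyclic p≤d)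

  parameter-extend : ∀ s o p → Acyclic U' o → p ≤ d → parameter s (extend s o p) ≡ p
  parameter-extend (inj₁ a) o p acyclic p≤d = indegree-extend (inj₁ a) o p acyclic p≤d
  parameter-extend (inj₂ b) o p acyclic p≤d =
    trans (cong (d ∸_) (indegree-extend (inj₂ b) o p acyclic p≤d)) (NP.m∸[m∸n]≡n p≤d)

  -- Every acyclic orientation o of G[U] is an extension of its restriction:
  -- the in-neighbours of u form an initial segment of K in the rank order.
  module Reconstruction (o : Orientation n) (acyclic : Acyclic U o) where

    private
      oo = proj₁ acyclic
      o' = restrict o
      acyclic' = restrict-acyclic o acyclic
    open Ranks o' acyclic'

    in-K : ∀ {x} → x ⇀[ o ] u → T (K x)
    in-K xu with arrow⇒edge oo xu
    ... | ux , _ , a = K-intro ux (Adj-sym a)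

    out-K : ∀ {x} → u ⇀[ o ] x → T (K x)
    out-K ux with arrow⇒edge oo ux
    ... | _ , ux , a = K-intro ux a

    indegree≤d : indegree o ≤ d
    indegree≤d = count-mono _ K (λ x → in-K)

    -- by transitivity on the clique K ∪ {u}, a vertex of K of lower rank than
    -- an in-neighbour of u is itself an in-neighbour of u
    in-downward-closed : ∀ {x y} → T (K x) → x ⇀[ o ] u → T (K y) → rank o' y ℕ.< rank o' x → y ⇀[ o ] u
    in-downward-closed {x} {y} kx xu ky ry<rx with y F.≟ x
    ... | yes refl = ⊥-elim (NP.<-irrefl refl ry<rx)
    ... | no y≢x with edge⇒arrow oo (K⊆U ky , u∈U , Adj-sym (K-adj ky))
    ... | inj₁ yu = yu
    ... | inj₂ uy = ⊥-elim (proj₂ acyclic cycle)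
      where
        cycle : HasDirectedCycle o
        cycle with edge⇒arrow (proj₁ acyclic') (K-edge ky kx y≢x)
        ... | inj₁ y→x = triangle {o = o} y≢x (K-≢u kx) (K-≢u ky) (restrict-⊆ o y x y→x) xu uy
        ... | inj₂ x→y = ⊥-elim (NP.<⇒≯ ry<rx (rank-increasing kx ky x→y))

    in⇒below : ∀ {x} → T (K x) → x ⇀[ o ] u → rank o' x ℕ.< indegree o
    in⇒below {x} kx xu = begin
        suc (rank o' x)         ≡⟨ sym (countBelow-exact (suc (rank o' x)) (rank<d kx)) ⟩
        countBelow (suc (rank o' x)) ≤⟨ count-mono _ _ below-in ⟩
        indegree o              ∎
      where
        open NP.≤-Reasoning
        below-in : ∀ y → T (K y ∧ (rank o' y <ᵇ suc (rank o' x))) → T (arrow o y u)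
        below-in y t with NP.m≤n⇒m<n∨m≡n (NP.≤-pred (<ᵇ-sound {rank o' y} (T-∧-snd {K y} t)))
        ... | inj₁ ry<rx = in-downward-closed kx xu (T-∧-fst t) ry<rx
        ... | inj₂ ry≡rx = subst (λ z → T (arrow o z u)) (sym (rank-injective (T-∧-fst t) kx ry≡rx)) xu

    below⇒in : ∀ {x} → T (K x) → rank o' x ℕ.< indegree o → x ⇀[ o ] u
    below⇒in {x} kx rx<s with T? (arrow o x u)
    ... | yes xu = xu
    ... | no ¬xu = ⊥-elim (NP.<-irrefl refl (NP.<-≤-trans rx<s s≤rx))
      where
        open NP.≤-Reasoning
        in-below : ∀ y → T (arrow o y u) → T (K y ∧ (rank o' y <ᵇ rank o' x))
        in-below y yu with NP.<-cmp (rank o' y) (rank o' x)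
        ... | tri< ry<rx _ _ = T-∧-intro (in-K yu) (NP.<⇒<ᵇ ry<rx)
        ... | tri≈ _ ry≡rx _ = ⊥-elim (¬xu (subst (λ z → T (arrow o z u)) (rank-injective (in-K yu) kx ry≡rx) yu))
        ... | tri> _ _ rx<ry = ⊥-elim (¬xu (in-downward-closed (in-K yu) yu kx rx<ry))
        s≤rx : indegree o ≤ rank o' x
        s≤rx = begin
          indegree o          ≤⟨ count-mono _ _ in-below ⟩
          countBelow (rank o' x) ≡⟨ countBelow-exact (rank o' x) (NP.<⇒≤ (rank<d kx)) ⟩
          rank o' x           ∎

    to-u : ∀ x → arrow o x u ≡ (K x ∧ (rank o' x <ᵇ indegree o))
    to-u x = T-ext (λ xu → T-∧-intro (in-K xu) (NP.<⇒<ᵇ (in⇒below (in-K xu) xu)))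
                   (λ t → below⇒in (T-∧-fst t) (<ᵇ-sound {rank o' x} (T-∧-snd {K x} t)))

    from-u : ∀ x → arrow o u x ≡ (K x ∧ not (rank o' x <ᵇ indegree o))
    from-u x = T-ext (λ ux → T-∧-intro (out-K ux) (subst (λ b → T (not b)) (sym (to-u-false ux)) tt))
                     (λ t → ux (T-∧-fst t) (T-not⁻ (T-∧-snd {K x} t)))
      where
        to-u-false : u ⇀[ o ] x → (rank o' x <ᵇ indegree o) ≡ false
        to-u-false ux = ¬T⇒≡false (λ lt → arrow-asym oo ux (below⇒in (out-K ux) (<ᵇ-sound {rank o' x} lt)))
        ux : T (K x) → ¬ T (rank o' x <ᵇ indegree o) → u ⇀[ o ] x
        ux kx ¬lt with edge⇒arrow oo (u∈U , K⊆U kx , K-adj kx)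
        ... | inj₁ u→x = u→x
        ... | inj₂ x→u = ⊥-elim (¬lt (NP.<⇒<ᵇ (in⇒below kx x→u)))

    threshold-parameter : ∀ s → threshold s (parameter s o) ≡ indegree o
    threshold-parameter (inj₁ _) = refl
    threshold-parameter (inj₂ _) = NP.m∸[m∸n]≡n indegree≤d

    parameter-≤ : ∀ s → parameter s o ≤ d
    parameter-≤ (inj₁ _) = indegree≤d
    parameter-≤ (inj₂ _) = NP.m∸n≤m d (indegree o)

    reconstruct : ∀ s → o ≡ extend s o' (parameter s o)
    reconstruct s = orientation-ext _ _ same
      where
        cut : ℕ
        cut = parameter s o
        same : ∀ i j → arrow o i j ≡ arrow (extend s o' cut) i j
        same i j with i F.≟ u | j F.≟ u
        ... | yes refl | _ = trans (from-u j) (sym (trans (extend-from-u s o' cut j)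
                               (cong (λ t → K j ∧ not (rank o' j <ᵇ t)) (threshold-parameter s))))
        ... | no _ | yes refl = trans (to-u i) (sym (trans (extend-to-u s o' cut i)
                               (cong (λ t → K i ∧ (rank o' i <ᵇ t)) (threshold-parameter s))))
        ... | no i≢u | no j≢u = trans (sym (restrict-off-u o i j i≢u j≢u)) (sym (extend-off-u s o' cut i j i≢u j≢u))

  -- Descents.  Besides those of o, the extension has descents only on the
  -- edges at u; K lying on one side of u, these number exactly p.
  private
    arrow-split : ∀ s o p → OrientsOn U' o → ∀ i j →
      𝟙 (arrow (extend s o p) i j) ≡ 𝟙 (arrow o i j) + (𝟙 ((i == u) ∧ cutAbove s o p j) + 𝟙 ((j == u) ∧ cutBelow s o p i))
    arrow-split s o p oo i j with i F.≟ u
    ... | yes refl rewrite extend-from-u s o p j | ¬T⇒≡false (no-arrow-from-u oo j)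
                         | K-u≡false | ∧-zeroʳ (j == u) = sym (NP.+-identityʳ _)
    ... | no i≢u with j F.≟ u
    ...   | yes refl rewrite extend-to-u s o p i | ¬T⇒≡false (no-arrow-to-u oo i) = refl
    ...   | no j≢u rewrite extend-off-u s o p i j i≢u j≢u = sym (NP.+-identityʳ _)

  descents-at-u : ∀ s o p → Acyclic U' o → p ≤ d →
                  count (λ j → cutAbove s o p j ∧ (j <ᶠ u)) + count (λ i → cutBelow s o p i ∧ (u <ᶠ i)) ≡ p
  descents-at-u s@(inj₁ above) o p acyclic p≤d = cong₂ _+_
    (count-∧-none (cutAbove s o p) _ (λ j t j<u → FP.<-asym (<ᶠ-sound j<u) (K-above (T-∧-fst t))))
    (trans (count-∧-all (cutBelow s o p) _ (λ i t → fromWitness (K-above (T-∧-fst t)))) (cutBelow-size s o p acyclic p≤d))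
    where K-above : ∀ {x} → T (K x) → u F.< x
          K-above kx = above _ (K⊆U kx) (K-adj kx)
  descents-at-u s@(inj₂ below) o p acyclic p≤d = begin
      count (λ j → cutAbove s o p j ∧ (j <ᶠ u)) + count (λ i → cutBelow s o p i ∧ (u <ᶠ i))
        ≡⟨ cong₂ _+_ (count-∧-all (cutAbove s o p) _ (λ j t → fromWitness (K-below (T-∧-fst t))))
                     (count-∧-none (cutBelow s o p) _ (λ i t u<i → FP.<-asym (<ᶠ-sound u<i) (K-below (T-∧-fst t)))) ⟩
      count (cutAbove s o p) + 0
        ≡⟨ NP.+-identityʳ _ ⟩
      count (cutAbove s o p)
        ≡⟨ sym (NP.m+n∸m≡n (count (cutBelow s o p)) _) ⟩
      count (cutBelow s o p) + count (cutAbove s o p) ∸ count (cutBelow s o p)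
        ≡⟨ cong₂ _∸_ (sym (count-split K (λ x → rank o x <ᵇ threshold s p))) (cutBelow-size s o p acyclic p≤d) ⟩
      d ∸ (d ∸ p)
        ≡⟨ NP.m∸[m∸n]≡n p≤d ⟩
      p ∎
    where
      open ≡-Reasoning
      K-below : ∀ {x} → T (K x) → x F.< u
      K-below kx = below _ (K⊆U kx) (K-adj kx)

  des-extend : ∀ s o p → Acyclic U' o → p ≤ d → des (extend s o p) ≡ des o + p
  des-extend s o p acyclic p≤d = begin
      des (extend s o p)
        ≡⟨ descentSum-+ _ (λ i j → 𝟙 (arrow o i j)) _ (arrow-split s o p (proj₁ acyclic)) ⟩
      des o + descentSum (λ i j → 𝟙 ((i == u) ∧ cutAbove s o p j) + 𝟙 ((j == u) ∧ cutBelow s o p i))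
        ≡⟨ cong (des o +_) (descentSum-+ _ (λ i j → 𝟙 ((i == u) ∧ cutAbove s o p j))
                                            (λ i j → 𝟙 ((j == u) ∧ cutBelow s o p i)) (λ _ _ → refl)) ⟩
      des o + (descentSum (λ i j → 𝟙 ((i == u) ∧ cutAbove s o p j)) + descentSum (λ i j → 𝟙 ((j == u) ∧ cutBelow s o p i)))
        ≡⟨ cong (des o +_) (cong₂ _+_ (descentSum-row u (cutAbove s o p)) (descentSum-column u (cutBelow s o p))) ⟩
      des o + (count (λ j → cutAbove s o p j ∧ (j <ᶠ u)) + count (λ i → cutBelow s o p i ∧ (u <ᶠ i)))
        ≡⟨ cong (des o +_) (descents-at-u s o p acyclic p≤d) ⟩
      des o + p ∎
    where open ≡-Reasoning

  side : OneSided U u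
  side = proj₂ nice

  cuts : List ℕ
  cuts = upTo (d + 1)

  ∈cuts⇒≤d : ∀ {p} → p ∈ cuts → p ≤ d
  ∈cuts⇒≤d {p} p∈ = NP.≤-pred (subst (p ℕ.<_) (NP.+-comm d 1) (∈-upTo⁻ p∈))

  ≤d⇒∈cuts : ∀ {p} → p ≤ d → p ∈ cuts
  ≤d⇒∈cuts {p} p≤d = ∈-upTo⁺ (subst (p ℕ.<_) (NP.+-comm 1 d) (s≤s p≤d))

  extensions : List (Orientation n) → List (Orientation n)
  extensions L = map (uncurry (extend side)) (cartesianProduct L cuts)

  extensions-enumerate : (∀ o → Acyclic U' o → Potential o) → ∀ {L} → Enumerates U' L → Enumerates U (extensions L)
  extensions-enumerate potential {L} (uniqueL , soundL , completeL) = unique , sound , complete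
    where
      recover : ∀ op → op ∈ cartesianProduct L cuts →
                (restrict (uncurry (extend side) op) , parameter side (uncurry (extend side) op)) ≡ op
      recover (o , p) m with ∈-cartesianProduct⁻ L cuts m
      ... | o∈L , p∈ = cong₂ _,_ (restrict-extend side o p (proj₁ (soundL o o∈L)))
                                 (parameter-extend side o p (soundL o o∈L) (∈cuts⇒≤d p∈))

      unique : Unique (extensions L)
      unique = Unique-map-leftInverse (uncurry (extend side)) (λ o → restrict o , parameter side o)
                 (UniqueP.cartesianProduct⁺ uniqueL (UniqueP.upTo⁺ (d + 1))) recover

      sound : ∀ o → o ∈ extensions L → Acyclic U o
      sound _ m with ∈-map⁻ (uncurry (extend side)) m
      ... | (o , p) , op∈ , refl with ∈-cartesianProduct⁻ L cuts op∈
      ... | o∈L , _ = extend-orients side o p (proj₁ (soundL o o∈L)) ,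
                      potential⇒acyclic {o = extend side o p} (extend-potential side o p (soundL o o∈L) (potential o (soundL o o∈L)))

      complete : ∀ o → Acyclic U o → o ∈ extensions L
      complete o acyclic = subst (_∈ extensions L) (sym (reconstruct side))
        (∈-map⁺ (uncurry (extend side)) (∈-cartesianProduct⁺ (completeL (restrict o) (restrict-acyclic o acyclic))
                                                             (≤d⇒∈cuts (parameter-≤ side))))
        where open Reconstruction o acyclic

  sum-over-cuts : ∀ o → Acyclic U' o → ∀ q → sum (map (λ p → q ^ des (extend side o p)) cuts) ≡ [ d + 1 ] q * q ^ des o
  sum-over-cuts o acyclic q = begin
      sum (map (λ p → q ^ des (extend side o p)) cuts)
        ≡⟨ sum-cong _ _ cuts (λ p p∈ → trans (cong (q ^_) (des-extend side o p acyclic (∈cuts⇒≤d p∈)))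
                                              (NP.^-distribˡ-+-* q (des o) p)) ⟩
      sum (map (λ p → q ^ des o * q ^ p) cuts)
        ≡⟨ sum-* (q ^ des o) (q ^_) cuts ⟩
      q ^ des o * [ d + 1 ] q
        ≡⟨ NP.*-comm (q ^ des o) _ ⟩
      [ d + 1 ] q * q ^ des o ∎
    where open ≡-Reasoning

  R-extensions : ∀ {L} → Enumerates U' L → ∀ q → R-via (extensions L) q ≡ [ d + 1 ] q * R-via L q
  R-extensions {L} (_ , soundL , _) q = begin
      sum (map (λ o → q ^ des o) (map (uncurry (extend side)) (cartesianProduct L cuts)))
        ≡⟨ cong sum (sym (map-∘ (cartesianProduct L cuts))) ⟩
      sum (map (λ op → q ^ des (uncurry (extend side) op)) (cartesianProduct L cuts))
        ≡⟨ sum-cartesianProduct (λ op → q ^ des (uncurry (extend side) op)) L cuts ⟩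
      sum (map (λ o → sum (map (λ p → q ^ des (extend side o p)) cuts)) L)
        ≡⟨ sum-cong _ _ L (λ o o∈L → sum-over-cuts o (soundL o o∈L) q) ⟩
      sum (map (λ o → [ d + 1 ] q * q ^ des o) L)
        ≡⟨ sum-* ([ d + 1 ] q) (λ o → q ^ des o) L ⟩
      [ d + 1 ] q * R-via L q ∎
    where open ≡-Reasoning

-- Non-adjacent vertices of G_w are ordered alike by position and value, so a
-- vertex fails to be simplicial through an increasing pair of neighbours.
module Obstructions {n : ℕ} (w : S n) where
  open Graph w

  W : Fin n → Fin n
  W x = w ⟨$⟩ʳ x

  W-injective : ∀ {x y} → W x ≡ W y → x ≡ y
  W-injective {x} {y} e = trans (sym (inverseˡ w)) (trans (cong (w ⟨$⟩ˡ_) e) (inverseˡ w))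

  non-adjacent-ordered : ∀ {x y} → x ≢ y → ¬ Adj w x y → (x F.< y × W x F.< W y) ⊎ (y F.< x × W y F.< W x)
  non-adjacent-ordered {x} {y} x≢y ¬a with FP.<-cmp x y | FP.<-cmp (W x) (W y)
  ... | tri≈ _ x≡y _ | _ = ⊥-elim (x≢y x≡y)
  ... | _ | tri≈ _ Wx≡Wy _ = ⊥-elim (x≢y (W-injective Wx≡Wy))
  ... | tri< x<y _ _ | tri< Wx<Wy _ _ = inj₁ (x<y , Wx<Wy)
  ... | tri< x<y _ _ | tri> _ _ Wy<Wx = ⊥-elim (¬a (inj₁ (x<y , Wy<Wx)))
  ... | tri> _ _ y<x | tri< Wx<Wy _ _ = ⊥-elim (¬a (inj₂ (y<x , Wx<Wy)))
  ... | tri> _ _ y<x | tri> _ _ Wy<Wx = inj₂ (y<x , Wy<Wx)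

  Obstruction : Sub n → Fin n → Set
  Obstruction U v = Σ (Fin n) λ x → Σ (Fin n) λ y →
    T (U x) × T (U y) × Adj w v x × Adj w v y × x F.< y × W x F.< W y

  simplicial-or-obstruction : ∀ U v → T (U v) → Simplicial U v ⊎ Obstruction U v
  simplicial-or-obstruction U v uv with any-pair
    where
      any-pair = FP.any? λ x → FP.any? λ y → T? (U x) ×-dec (T? (U y) ×-dec (adj? w v x ×-dec (adj? w v y ×-dec
                   (¬? (x F.≟ y) ×-dec ¬? (adj? w x y)))))
  ... | no none = inj₁ (uv , λ x y ux uy ax ay x≢y →
                   decidable-stable (adj? w x y) (λ ¬a → none (x , y , ux , uy , ax , ay , x≢y , ¬a)))
  ... | yes (x , y , ux , uy , ax , ay , x≢y , ¬a) with non-adjacent-ordered x≢y ¬a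
  ... | inj₁ (x<y , Wx<Wy) = inj₂ (x , y , ux , uy , ax , ay , x<y , Wx<Wy)
  ... | inj₂ (y<x , Wy<Wx) = inj₂ (y , x , uy , ux , ay , ax , y<x , Wy<Wx)

  last-neighbour : ∀ {U : Sub n} {l : Fin n} → (∀ x → T (U x) → toℕ x ≤ toℕ l) → ∀ {x} → T (U x) → Adj w l x →
                   x F.< l × W l F.< W x
  last-neighbour last ux (inj₁ (l<x , _)) = ⊥-elim (NP.<⇒≱ l<x (last _ ux))
  last-neighbour last ux (inj₂ below) = below

  top-neighbour : ∀ {U : Sub n} {m : Fin n} → (∀ x → T (U x) → toℕ (W x) ≤ toℕ (W m)) → ∀ {x} → T (U x) → Adj w m x →
                  m F.< x × W x F.< W m
  top-neighbour top ux (inj₁ above) = above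
  top-neighbour top ux (inj₂ (_ , Wm<Wx)) = ⊥-elim (NP.<⇒≱ Wm<Wx (top _ ux))

module PatternAvoidance {n : ℕ} (w : S n) (¬3412 : ¬ Contains3412 w) (¬4231 : ¬ Contains4231 w) where
  open Graph w
  open Obstructions w

  -- Obstructions a < b at the last vertex l and c < d at the highest vertex m
  -- of U cannot coexist: the six values contain a 3412 or 4231 pattern.
  no-two-obstructions : ∀ {l m a b c d} →
    a F.< b → W a F.< W b → b F.< l → W l F.< W a →
    c F.< d → W c F.< W d → m F.< c → W d F.< W m →
    toℕ d ≤ toℕ l → toℕ (W a) ≤ toℕ (W m) → toℕ (W b) ≤ toℕ (W m) → ⊥
  no-two-obstructions {l} {m} {a} {b} {c} {d} a<b Wa<Wb b<l Wl<Wa c<d Wc<Wd m<c Wd<Wm d≤l Wa≤Wm Wb≤Wm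
    with FP.<-cmp (W c) (W l)
  ... | tri> _ _ Wl<Wc = ¬4231 (m , c , d , l , m<c , c<d , d<l , Wl<Wc , Wc<Wd , Wd<Wm)
    where d<l : d F.< l
          d<l = NP.≤∧≢⇒< d≤l (λ d≡l → NP.<-asym Wl<Wc (subst (λ z → W c F.< W z) (FP.toℕ-injective d≡l) Wc<Wd))
  ... | tri≈ _ Wc≡Wl _ = NP.<-irrefl refl (NP.<-≤-trans c<d (subst (λ z → toℕ d ≤ toℕ z) (sym (W-injective Wc≡Wl)) d≤l))
  ... | tri< Wc<Wl _ _ with FP.<-cmp a m
  ...   | tri< a<m _ _ = ¬3412 (a , m , c , l , a<m , m<c , NP.<-≤-trans c<d d≤l , Wc<Wl , Wl<Wa , Wa<Wm)
    where Wa<Wm : W a F.< W m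
          Wa<Wm = NP.≤∧≢⇒< Wa≤Wm (λ Wa≡Wm → NP.<-irrefl refl (NP.<-≤-trans
                    (subst (λ z → W z F.< W b) (W-injective (FP.toℕ-injective Wa≡Wm)) Wa<Wb) Wb≤Wm))
  ...   | tri≈ _ a≡m _ = NP.<-irrefl refl (NP.<-≤-trans (subst (λ z → W z F.< W b) a≡m Wa<Wb) Wb≤Wm)
  ...   | tri> _ _ m<a = ¬4231 (m , a , b , l , m<a , a<b , b<l , Wl<Wa , Wa<Wb , Wb<Wm)
    where Wb<Wm : W b F.< W m
          Wb<Wm = NP.≤∧≢⇒< Wb≤Wm (λ Wb≡Wm → FP.<-irrefl (sym (W-injective (FP.toℕ-injective Wb≡Wm))) (FP.<-trans m<a a<b))

  -- every nonempty U has a nice simplicial vertex: its last vertex if that is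
  -- simplicial (its neighbours precede it), else its highest vertex (its
  -- neighbours follow it); only the specification matters, hence opaque
  opaque
    nice-vertex : ∀ (U : Sub n) a → T (U a) → Σ (Fin n) (Nice U)
    nice-vertex U a ua with argmaxOn U toℕ a ua | argmaxOn U (λ x → toℕ (W x)) a ua
    ... | l , ul , last | m , um , top
      with simplicial-or-obstruction U l ul | simplicial-or-obstruction U m um
    ... | inj₁ simp-l | _ = l , simp-l , inj₂ (λ x ux lx → proj₁ (last-neighbour {U} last ux lx))
    ... | inj₂ _ | inj₁ simp-m = m , simp-m , inj₁ (λ x ux mx → proj₁ (top-neighbour {U} top ux mx))
    ... | inj₂ (a' , b , ua' , ub , la' , lb , a'<b , Wa'<Wb) | inj₂ (c , d , uc , ud , mc , md , c<d , Wc<Wd) =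
      ⊥-elim (no-two-obstructions a'<b Wa'<Wb (proj₁ (last-neighbour {U} last ub lb)) (proj₂ (last-neighbour {U} last ua' la'))
                                  c<d Wc<Wd (proj₁ (top-neighbour {U} top uc mc)) (proj₂ (top-neighbour {U} top ud md))
                                  (last d ud) (top a' ua') (top b ub))

module Enumeration {n : ℕ} (w : S n) (¬3412 : ¬ Contains3412 w) (¬4231 : ¬ Contains4231 w) where
  open Graph w
  open PatternAvoidance w ¬3412 ¬4231 using (nice-vertex)

  no-arrows : Orientation n
  no-arrows = fromArrows (λ _ _ → false)

  no-arrows-arrow : ∀ i j → ¬ T (arrow no-arrows i j)
  no-arrows-arrow i j t = subst T (arrow-fromArrows (λ _ _ → false) i j) t

  module Empty (U : Sub n) (empty : ∀ x → ¬ T (U x)) where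

    no-arrow : ∀ {o} → OrientsOn U o → ∀ i j → ¬ (i ⇀[ o ] j)
    no-arrow oo i j a = empty i (proj₁ (arrow⇒edge oo a))

    enumerate : Enumerates U (no-arrows ∷ [])
    enumerate = ([] ∷ []) , (λ { o (here refl) → acyclic }) , λ o a → here (only o (proj₁ a))
      where
        acyclic : Acyclic U no-arrows
        acyclic = orients (λ i j e → ⊥-elim (empty i (proj₁ e))) (λ i j _ → no-arrows-arrow i j) ,
                  potential⇒acyclic {o = no-arrows} ((λ _ → 0) , λ i j a → ⊥-elim (no-arrows-arrow i j a))
        only : ∀ o → OrientsOn U o → o ≡ no-arrows
        only o oo = orientation-ext _ _ (λ i j → trans (¬T⇒≡false (no-arrow oo i j)) (sym (¬T⇒≡false (no-arrows-arrow i j))))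

    potential : ∀ o → Acyclic U o → Potential o
    potential o (oo , _) = (λ _ → 0) , λ i j a → ⊥-elim (no-arrow oo i j a)

    des-no-arrows : des no-arrows ≡ 0
    des-no-arrows = descentSum-zero _ (λ i j → cong 𝟙 (¬T⇒≡false (no-arrows-arrow i j)))

  -- by induction on |U|: an enumeration, and a potential for every acyclic
  -- orientation (which the extension step needs for the smaller graph)
  enumerate-with-potentials : ∀ k (U : Sub n) → count U ≡ k →
    Σ (List (Orientation n)) (Enumerates U) × (∀ o → Acyclic U o → Potential o)
  enumerate-with-potentials zero U e = (no-arrows ∷ [] , enumerate) , potential
    where open Empty U (count-0⇒empty U e)
  enumerate-with-potentials (suc k) U e with count-pos U e
  ... | a , ua with nice-vertex U a ua
  ... | u , nu with enumerate-with-potentials k (U ─ u) (NP.suc-injective (trans (sym (count-─ U u (proj₁ (proj₁ nu)))) e))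
  ... | (L , enumerates) , potential' =
        (extensions L , extensions-enumerate potential' enumerates) ,
        λ o acyclic → potential-from-restriction o acyclic (potential' (restrict o) (restrict-acyclic o acyclic))
    where open Extension w U u nu

  -- only the specifications matter, hence opaque
  opaque
    enumeration : ∀ (U : Sub n) → Σ (List (Orientation n)) (Enumerates U)
    enumeration U = proj₁ (enumerate-with-potentials (count U) U refl)

    acyclic⇒potential : ∀ (U : Sub n) o → Acyclic U o → Potential o
    acyclic⇒potential U = proj₂ (enumerate-with-potentials (count U) U refl)

  R : Sub n → ℕ → ℕ
  R U q = R-via (proj₁ (enumeration U)) q

  R-any : ∀ {U L} → Enumerates U L → ∀ q → R-via L q ≡ R U q
  R-any enumerates = enumeration-unique (λ _ → refl) enumerates (proj₂ (enumeration _))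

  R-cong : ∀ {U V} → (∀ x → U x ≡ V x) → ∀ q → R U q ≡ R V q
  R-cong U≡V = enumeration-unique U≡V (proj₂ (enumeration _)) (proj₂ (enumeration _))

  R-empty : ∀ U → count U ≡ 0 → ∀ q → R U q ≡ 1
  R-empty U e q = begin
      R U q                    ≡⟨ sym (R-any enumerate q) ⟩
      q ^ des no-arrows + 0    ≡⟨ cong (λ t → q ^ t + 0) des-no-arrows ⟩
      1                        ∎
    where
      open ≡-Reasoning
      open Empty U (count-0⇒empty U e)

  R-nice : ∀ {U u} → Nice U u → ∀ q → R U q ≡ [ deg U u + 1 ] q * R (U ─ u) q
  R-nice {U} {u} nice q =
    trans (sym (R-any (extensions-enumerate (acyclic⇒potential (U ─ u)) enumerates) q)) (R-extensions enumerates q)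
    where
      open Extension w U u nice
      enumerates = proj₂ (enumeration (U ─ u))

  -- The factorisation at an arbitrary simplicial vertex v, by induction on |U|:
  -- delete a nice vertex u ≠ v first, then v, and exchange the two deletions.
  R-simplicial′ : ∀ k U v → count U ≡ k → Simplicial U v → ∀ q → R U q ≡ [ deg U v + 1 ] q * R (U ─ v) q
  R-simplicial′ zero U v e sv = ⊥-elim (count-0⇒empty U e v (proj₁ sv))
  R-simplicial′ (suc k) U v e sv q with nice-vertex U v (proj₁ sv)
  ... | u , nu with u F.≟ v
  ... | yes refl = R-nice nu q
  ... | no u≢v = begin
      R U q
        ≡⟨ R-nice nu q ⟩
      [ deg U u + 1 ] q * R (U ─ u) q
        ≡⟨ cong ([ deg U u + 1 ] q *_) (R-simplicial′ k (U ─ u) v |U─u| sv′ q) ⟩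
      [ deg U u + 1 ] q * ([ deg (U ─ u) v + 1 ] q * R ((U ─ u) ─ v) q)
        ≡⟨ deletion-factors-commute U u v (proj₁ nu) sv q _ ⟩
      [ deg U v + 1 ] q * ([ deg (U ─ v) u + 1 ] q * R ((U ─ u) ─ v) q)
        ≡⟨ cong (λ t → [ deg U v + 1 ] q * ([ deg (U ─ v) u + 1 ] q * t)) (R-cong (─-comm U u v) q) ⟩
      [ deg U v + 1 ] q * ([ deg (U ─ v) u + 1 ] q * R ((U ─ v) ─ u) q)
        ≡⟨ cong ([ deg U v + 1 ] q *_) (sym (R-nice nu′ q)) ⟩
      [ deg U v + 1 ] q * R (U ─ v) q ∎
    where
      open ≡-Reasoning
      |U─u| : count (U ─ u) ≡ k
      |U─u| = NP.suc-injective (trans (sym (count-─ U u (proj₁ (proj₁ nu)))) e)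
      sv′ : Simplicial (U ─ u) v
      sv′ = Simplicial-sub (λ _ → T-∧-fst) (─-intro {U = U} (proj₁ sv) (≢-sym u≢v)) sv
      nu′ : Nice (U ─ v) u
      nu′ = Nice-sub (λ _ → T-∧-fst) (─-intro {U = U} (proj₁ (proj₁ nu)) u≢v) nu

  R-simplicial : ∀ {U v} → Simplicial U v → ∀ q → R U q ≡ [ deg U v + 1 ] q * R (U ─ v) q
  R-simplicial {U} {v} = R-simplicial′ (count U) U v refl

module Ordering {n : ℕ} (w : S n) (σ : Permutation′ n) where
  open Graph w

  vertex : Fin n → Fin n
  vertex i = σ ⟨$⟩ʳ i

  position : Fin n → Fin n
  position y = σ ⟨$⟩ˡ y

  vertex-position : ∀ y → vertex (position y) ≡ y
  vertex-position y = inverseʳ σ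

  vertex-injective : ∀ {i j} → vertex i ≡ vertex j → i ≡ j
  vertex-injective {i} {j} e = trans (sym (inverseˡ σ)) (trans (cong position e) (inverseˡ σ))

  earlier? : Fin n → Fin n → Bool
  earlier? i j = isYes (j FP.<? i ×-dec adj? w (vertex i) (vertex j))

  exponentOn : Sub n → Fin n → ℕ
  exponentOn U i = sum (map (λ j → 𝟙 (U (vertex j) ∧ earlier? i j)) (allFin n))

  factorOn : Sub n → ℕ → Fin n → ℕ
  factorOn U q i = if U (vertex i) then [ exponentOn U i + 1 ] q else 1

  productOn : Sub n → ℕ → ℕ
  productOn U q = product (map (factorOn U q) (allFin n))

  Last : Sub n → Fin n → Set
  Last U i₀ = T (U (vertex i₀)) × (∀ i → T (U (vertex i)) → toℕ i ≤ toℕ i₀)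

  last-position : ∀ (U : Sub n) a → T (U a) → Σ (Fin n) (Last U)
  last-position U a ua = argmaxOn (λ i → U (vertex i)) toℕ (position a) (subst (λ z → T (U z)) (sym (vertex-position a)) ua)

  last-earlier : ∀ {U i₀ x} → Last U i₀ → T (U x) → Adj w (vertex i₀) x → EarlierNbr w σ i₀ (position x)
  last-earlier {U} {i₀} {x} (_ , last) ux a =
    NP.≤∧≢⇒< (last (position x) (subst (λ z → T (U z)) (sym (vertex-position x)) ux))
             (λ e → Adj-≢ a (trans (cong vertex (sym (FP.toℕ-injective e))) (vertex-position x))) ,
    subst (Adj w (vertex i₀)) (sym (vertex-position x)) a

  reindex : ∀ (h : Fin n → ℕ) → sum (map (λ j → h (vertex j)) (allFin n)) ≡ sum (map h (allFin n))
  reindex h = trans (cong sum (map-∘ (allFin n)))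
    (sum-same-members h (UniqueP.map⁺ vertex-injective (UniqueP.allFin⁺ n)) (UniqueP.allFin⁺ n) (λ {y} _ → ∈-allFin y)
       (λ {y} _ → subst (_∈ map vertex (allFin n)) (vertex-position y)
                        (∈-map⁺ vertex (∈-allFin (position y)))))

  exponentOn-last : ∀ {U i₀} → Last U i₀ → exponentOn U i₀ ≡ deg U (vertex i₀)
  exponentOn-last {U} {i₀} lst =
    trans (sum-cong _ _ (allFin n) (λ j _ → cong 𝟙 (earlier-is-adjacent j))) (reindex (λ y → 𝟙 (U y ∧ adjB (vertex i₀) y)))
    where
      earlier-is-adjacent : ∀ j → (U (vertex j) ∧ earlier? i₀ j) ≡ (U (vertex j) ∧ adjB (vertex i₀) (vertex j))
      earlier-is-adjacent j = T-ext
        (λ t → T-∧-intro (T-∧-fst t) (adjB-complete (proj₂ (toWitness (T-∧-snd {U (vertex j)} t)))))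
        (λ t → let uj = T-∧-fst {U (vertex j)} t
                   earlier = last-earlier {U} lst uj (adjB-sound (T-∧-snd {U (vertex j)} t))
               in T-∧-intro uj (fromWitness (subst (F._< i₀) (inverseˡ σ) (proj₁ earlier) ,
                                             subst (λ z → Adj w (vertex i₀) (vertex z)) (inverseˡ σ) (proj₂ earlier))))

  productOn-last : ∀ {U i₀} → Last U i₀ → ∀ q → productOn U q ≡ [ deg U (vertex i₀) + 1 ] q * productOn (U ─ vertex i₀) q
  productOn-last {U} {i₀} lst q =
    trans (prod-delta (factorOn U q) (factorOn (U ─ v) q) (UniqueP.allFin⁺ n) (∈-allFin i₀) same-factor removed-factor)
          (cong (_* productOn (U ─ v) q) (trans (cong (λ b → if b then [ exponentOn U i₀ + 1 ] q else 1) (T⇒≡true (proj₁ lst)))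
                                                (cong (λ e → [ e + 1 ] q) (exponentOn-last lst))))
    where
      v = vertex i₀
      removed-factor : factorOn (U ─ v) q i₀ ≡ 1
      removed-factor rewrite ==-refl v | ∧-zeroʳ (U v) = refl
      in-U─v : ∀ {i} → i ≢ i₀ → (U ─ v) (vertex i) ≡ U (vertex i)
      in-U─v i≢i₀ = T-ext T-∧-fst (λ t → ─-intro {U = U} t (λ e → i≢i₀ (vertex-injective e)))
      -- earlier neighbours of a position i ≤ i₀ are not at i₀
      same-exponent : ∀ i → T (U (vertex i)) → exponentOn U i ≡ exponentOn (U ─ v) i
      same-exponent i ui = sum-cong _ _ (allFin n) (λ j _ → cong 𝟙 (T-ext
        (λ t → T-∧-intro (─-intro {U = U} (T-∧-fst t) (λ e → FP.<-irrefl refl (subst (F._< i₀) (vertex-injective e)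
                            (NP.<-≤-trans (proj₁ (toWitness (T-∧-snd {U (vertex j)} t))) (proj₂ lst i ui)))))
                         (T-∧-snd {U (vertex j)} t))
        (λ t → T-∧-intro (T-∧-fst (T-∧-fst t)) (T-∧-snd {(U ─ v) (vertex j)} t))))
      same-factor : ∀ i → i ≢ i₀ → factorOn U q i ≡ factorOn (U ─ v) q i
      same-factor i i≢i₀ rewrite in-U─v i≢i₀ with U (vertex i) in ui
      ... | false = refl
      ... | true = cong (λ e → [ e + 1 ] q) (same-exponent i (subst T (sym ui) tt))

  productOn-empty : ∀ (U : Sub n) → (∀ x → ¬ T (U x)) → ∀ q → productOn U q ≡ 1
  productOn-empty U empty q = trans (cong product (map-cong (λ i → cong (λ b → if b then [ exponentOn U i + 1 ] q else 1)
                                                                     (¬T⇒≡false (empty (vertex i)))) (allFin n)))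
                                    (product-ones (allFin n))
    where
      product-ones : ∀ (xs : List (Fin n)) → product (map (λ _ → 1) xs) ≡ 1
      product-ones [] = refl
      product-ones (_ ∷ xs) = trans (NP.+-identityʳ _) (product-ones xs)

module EliminationProduct {n : ℕ} (w : S n) (¬3412 : ¬ Contains3412 w) (¬4231 : ¬ Contains4231 w)
                          (σ : Permutation′ n) (peo : IsPEO w σ) where
  open Graph w
  open Enumeration w ¬3412 ¬4231
  open Ordering w σ

  -- the earlier neighbours of each vertex form a clique, so the last vertex
  -- of σ in U is simplicial in G[U]
  last-simplicial : ∀ {U i₀} → Last U i₀ → Simplicial U (vertex i₀)
  last-simplicial {U} {i₀} lst = proj₁ lst , clique
    where
      clique : ∀ x y → T (U x) → T (U y) → Adj w (vertex i₀) x → Adj w (vertex i₀) y → x ≢ y → Adj w x y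
      clique x y ux uy ax ay x≢y = subst₂ (Adj w) (vertex-position x) (vertex-position y)
        (peo i₀ (position x) (position y) (last-earlier lst ux ax) (last-earlier lst uy ay)
             (λ e → x≢y (trans (sym (vertex-position x)) (trans (cong vertex e) (vertex-position y)))))

  R≡productOn : ∀ k (U : Sub n) → count U ≡ k → ∀ q → R U q ≡ productOn U q
  R≡productOn zero U e q = trans (R-empty U e q) (sym (productOn-empty U (count-0⇒empty U e) q))
  R≡productOn (suc k) U e q with count-pos U e
  ... | a , ua with last-position U a ua
  ... | i₀ , lst = begin
      R U q                                                      ≡⟨ R-simplicial (last-simplicial lst) q ⟩
      [ deg U (vertex i₀) + 1 ] q * R (U ─ vertex i₀) q          ≡⟨ cong ([ deg U (vertex i₀) + 1 ] q *_) (R≡productOn k _ |U─v| q) ⟩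
      [ deg U (vertex i₀) + 1 ] q * productOn (U ─ vertex i₀) q  ≡⟨ sym (productOn-last lst q) ⟩
      productOn U q                                              ∎
    where
      open ≡-Reasoning
      |U─v| : count (U ─ vertex i₀) ≡ k
      |U─v| = NP.suc-injective (trans (sym (count-─ U (vertex i₀) (proj₁ lst))) e)

  R-whole : ∀ q → R whole q ≡ expProduct w σ q
  R-whole = R≡productOn _ whole refl

-- A nice perfect elimination ordering is built from the back: position k
-- receives a nice vertex of the subgraph induced by the first k+1 vertices,
-- moved there by a transposition which leaves the later positions unchanged.
module NiceOrdering {n : ℕ} (w : S n) (¬3412 : ¬ Contains3412 w) (¬4231 : ¬ Contains4231 w) where
  open Graph w
  open PatternAvoidance w ¬3412 ¬4231 using (nice-vertex)

  Prefix : Permutation′ n → Fin n → Sub n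
  Prefix σ i y = isYes (toℕ (σ ⟨$⟩ˡ y) ℕ.≤? toℕ i)

  NiceFrom : Permutation′ n → ℕ → Set
  NiceFrom σ k = ∀ i → k ≤ toℕ i → Nice (Prefix σ i) (σ ⟨$⟩ʳ i)

  Nice-cong : ∀ {U V u} → (∀ x → U x ≡ V x) → Nice U u → Nice V u
  Nice-cong {U} {V} {u} U≡V nu = Nice-sub (λ x → subst T (sym (U≡V x))) (subst T (U≡V u) (proj₁ (proj₁ nu))) nu

  transpose-right : ∀ (a b : Fin n) → PC.transpose a b b ≡ a
  transpose-right a b with b F.≟ a
  ... | yes b≡a = b≡a
  ... | no _ with b F.≟ b
  ...   | yes _ = refl
  ...   | no b≢b = ⊥-elim (b≢b refl)

  transpose-other : ∀ (a b x : Fin n) → x ≢ a → x ≢ b → PC.transpose a b x ≡ x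
  transpose-other a b x x≢a x≢b with x F.≟ a
  ... | yes x≡a = ⊥-elim (x≢a x≡a)
  ... | no _ with x F.≟ b
  ...   | yes x≡b = ⊥-elim (x≢b x≡b)
  ...   | no _ = refl

  transpose-≤ : ∀ (a b p : Fin n) t → toℕ a ≤ t → toℕ b ≤ t →
                (toℕ (PC.transpose a b p) ≤ t → toℕ p ≤ t) × (toℕ p ≤ t → toℕ (PC.transpose a b p) ≤ t)
  transpose-≤ a b p t a≤t b≤t with p F.≟ a
  ... | yes refl = (λ _ → a≤t) , (λ _ → b≤t)
  ... | no _ with p F.≟ b
  ...   | yes refl = (λ _ → b≤t) , (λ _ → a≤t)
  ...   | no _ = (λ p≤t → p≤t) , (λ p≤t → p≤t)

  nice-step : ∀ σ (k : Fin n) → NiceFrom σ (suc (toℕ k)) → Σ (Permutation′ n) λ σ' → NiceFrom σ' (toℕ k)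
  nice-step σ k nice-after = σ' , nice-from-k
    where
      U = Prefix σ k
      vk∈U : T (U (σ ⟨$⟩ʳ k))
      vk∈U = subst (λ z → T (isYes (toℕ z ℕ.≤? toℕ k))) (sym (inverseˡ σ)) (fromWitness NP.≤-refl)
      chosen = nice-vertex U (σ ⟨$⟩ʳ k) vk∈U
      u = proj₁ chosen
      j = σ ⟨$⟩ˡ u
      j≤k : toℕ j ≤ toℕ k
      j≤k = toWitness (proj₁ (proj₁ (proj₂ chosen)))
      σ' = transpose j k ∘ₚ σ
      prefix-unchanged : ∀ i → toℕ k ≤ toℕ i → ∀ y → Prefix σ' i y ≡ Prefix σ i y
      prefix-unchanged i k≤i y = T-ext (λ t → fromWitness (proj₁ bounds (toWitness t)))
                                       (λ t → fromWitness (proj₂ bounds (toWitness t)))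
        where bounds = transpose-≤ k j (σ ⟨$⟩ˡ y) (toℕ i) k≤i (NP.≤-trans j≤k k≤i)
      nice-from-k : NiceFrom σ' (toℕ k)
      nice-from-k i k≤i with NP.m≤n⇒m<n∨m≡n k≤i
      ... | inj₂ k≡i with FP.toℕ-injective k≡i
      ...   | refl = subst (Nice (Prefix σ' k)) (sym (trans (cong (σ ⟨$⟩ʳ_) (transpose-right j k)) (inverseʳ σ)))
                       (Nice-cong (λ y → sym (prefix-unchanged k NP.≤-refl y)) (proj₂ chosen))
      nice-from-k i k≤i | inj₁ k<i =
        subst (Nice (Prefix σ' i)) (cong (σ ⟨$⟩ʳ_) (sym (transpose-other j k i i≢j i≢k)))
              (Nice-cong (λ y → sym (prefix-unchanged i (NP.<⇒≤ k<i) y)) (nice-after i k<i))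
        where
          i≢k : i ≢ k
          i≢k refl = NP.<-irrefl refl k<i
          i≢j : i ≢ j
          i≢j refl = NP.<-irrefl refl (NP.≤-<-trans j≤k k<i)

  nice-suffix : ∀ m k → m + k ≡ n → Σ (Permutation′ n) λ σ → NiceFrom σ k
  nice-suffix zero k refl = Perm.id , λ i k≤i → ⊥-elim (NP.<⇒≱ (FP.toℕ<n i) k≤i)
  nice-suffix (suc m) k e with nice-suffix m (suc k) (trans (NP.+-suc m k) e)
  ... | σ , nice-after = map₂ (λ {σ'} → subst (NiceFrom σ') (FP.toℕ-fromℕ< k<n))
                               (nice-step σ k′ (subst (λ t → NiceFrom σ (suc t)) (sym (FP.toℕ-fromℕ< k<n)) nice-after))
    where
      k<n : k ℕ.< n
      k<n = subst (k ℕ.<_) e (s≤s (NP.m≤n+m k m))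
      k′ : Fin n
      k′ = fromℕ< k<n

  nice-peo : Σ (Permutation′ n) (IsNicePEO w)
  nice-peo with nice-suffix n 0 (NP.+-identityʳ n)
  ... | σ , nice = σ , peo , sides
    where
      in-prefix : ∀ {i j} → j F.< i → T (Prefix σ i (σ ⟨$⟩ʳ j))
      in-prefix {i} {j} j<i = fromWitness (subst (λ z → toℕ z ≤ toℕ i) (sym (inverseˡ σ)) (NP.<⇒≤ j<i))
      peo : IsPEO w σ
      peo i j k (j<i , aj) (k<i , ak) j≢k = proj₂ (proj₁ (nice i z≤n)) _ _ (in-prefix j<i) (in-prefix k<i) aj ak
        (λ e → j≢k (trans (sym (inverseˡ σ)) (trans (cong (σ ⟨$⟩ˡ_) e) (inverseˡ σ))))
      sides : ∀ i → (∀ j → EarlierNbr w σ i j → (σ ⟨$⟩ʳ i) F.< (σ ⟨$⟩ʳ j))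
                  ⊎ (∀ j → EarlierNbr w σ i j → (σ ⟨$⟩ʳ j) F.< (σ ⟨$⟩ʳ i))
      sides i with proj₂ (nice i z≤n)
      ... | inj₁ above = inj₁ (λ j (j<i , a) → above _ (in-prefix j<i) a)
      ... | inj₂ below = inj₂ (λ j (j<i , a) → below _ (in-prefix j<i) a)

module CycleIndices {m : ℕ} (3≤m : 3 ≤ m) where

  next-last : ∀ (t : Fin (suc m)) → toℕ t ≡ m → next t ≡ zero
  next-last t t≡m with toℕ t ℕ.≟ m
  ... | yes _ = refl
  ... | no t≢m = ⊥-elim (t≢m t≡m)

  next-other : ∀ (t : Fin (suc m)) → toℕ t ≢ m → toℕ (next t) ≡ suc (toℕ t)
  next-other t t≢m with toℕ t ℕ.≟ m
  ... | yes t≡m = ⊥-elim (t≢m t≡m)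
  ... | no t≢m′ = FP.toℕ-fromℕ< (s≤s (NP.≤∧≢⇒< (FP.toℕ≤pred[n] t) t≢m′))

  Step : ℕ → ℕ → Set
  Step a b = (a ≡ m × b ≡ 0) ⊎ (a ℕ.< m × b ≡ suc a)

  step : ∀ t → Step (toℕ t) (toℕ (next t))
  step t with toℕ t ℕ.≟ m
  ... | yes t≡m = inj₁ (t≡m , cong toℕ (next-last t t≡m))
  ... | no t≢m = inj₂ (NP.≤∧≢⇒< (FP.toℕ≤pred[n] t) t≢m , next-other t t≢m)

  previous : Fin (suc m) → Fin (suc m)
  previous zero = fromℕ m
  previous (suc s) = inject₁ s

  next-previous : ∀ t → next (previous t) ≡ t
  next-previous zero = next-last (fromℕ m) (FP.toℕ-fromℕ m)
  next-previous (suc s) = FP.toℕ-injective (trans (next-other (inject₁ s) s≢m) (cong suc (FP.toℕ-inject₁ s)))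
    where s≢m : toℕ (inject₁ s) ≢ m
          s≢m e = NP.<-irrefl (trans (sym (FP.toℕ-inject₁ s)) e) (FP.toℕ<n s)

  private
    small≢m : ∀ {k} → k ≡ m → k ℕ.< 3 → ⊥
    small≢m refl k<3 = NP.<⇒≱ k<3 3≤m

  one-step : ∀ {a b} → Step a b → b ≢ a
  one-step (inj₁ (refl , refl)) e = small≢m e (s≤s z≤n)
  one-step (inj₂ (_ , refl)) e = NP.1+n≢n e

  two-steps : ∀ {a b c} → Step a b → Step b c → c ≢ a
  two-steps (inj₁ (refl , refl)) (inj₁ (0≡m , _)) _ = small≢m 0≡m (s≤s z≤n)
  two-steps (inj₁ (refl , refl)) (inj₂ (_ , refl)) e = small≢m e (s≤s (s≤s z≤n))
  two-steps (inj₂ (_ , refl)) (inj₁ (e , refl)) refl = small≢m e (s≤s (s≤s z≤n))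
  two-steps {a} (inj₂ (_ , refl)) (inj₂ (_ , refl)) e = NP.m≢1+n+m a {1} (sym e)

  three-steps : ∀ {a b c d} → Step a b → Step b c → Step c d → d ≢ a
  three-steps (inj₁ (refl , refl)) (inj₁ (0≡m , _)) _ _ = small≢m 0≡m (s≤s z≤n)
  three-steps (inj₁ (refl , refl)) (inj₂ (_ , refl)) (inj₁ (1≡m , _)) _ = small≢m 1≡m (s≤s (s≤s z≤n))
  three-steps (inj₁ (refl , refl)) (inj₂ (_ , refl)) (inj₂ (_ , refl)) e = small≢m e (s≤s (s≤s (s≤s z≤n)))
  three-steps (inj₂ (_ , refl)) (inj₁ (_ , refl)) (inj₁ (0≡m , _)) _ = small≢m 0≡m (s≤s z≤n)
  three-steps (inj₂ (_ , refl)) (inj₁ (e , refl)) (inj₂ (_ , refl)) refl = small≢m e (s≤s (s≤s (s≤s z≤n)))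
  three-steps (inj₂ (_ , refl)) (inj₂ (_ , refl)) (inj₁ (e , refl)) refl = small≢m e (s≤s (s≤s (s≤s z≤n)))
  three-steps {a} (inj₂ (_ , refl)) (inj₂ (_ , refl)) (inj₂ (_ , refl)) e = NP.m≢1+n+m a {2} (sym e)

  previous≢next : ∀ t → previous t ≢ next t
  previous≢next t e = two-steps (step t) (step (next t)) (cong toℕ (trans (cong next (sym e)) (next-previous t)))

  next-previous≢next : ∀ t → next (previous t) ≢ next t
  next-previous≢next t e = one-step (step t) (cong toℕ (sym (trans (sym (next-previous t)) e)))

  next-next≢previous : ∀ t → next (next t) ≢ previous t
  next-next≢previous t e =
    three-steps (step (previous t)) (step (next (previous t))) (step (next (next (previous t))))
                (cong toℕ (trans (cong (λ z → next (next z)) (next-previous t)) e))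

-- A graph with a perfect elimination ordering is chordal: on a cycle of
-- length ≥ 4, the vertex eliminated last has its two cycle neighbours among
-- its earlier neighbours, so these are adjacent, giving a chord.
chordal : ∀ {n} (w : S n) (σ : Permutation′ n) → IsPEO w σ → Chordal w
chordal {n} w σ peo k c (injective , adjacent) =
  previous t , next t , previous≢next t , next-previous≢next t , next-next≢previous t , chord
  where
    open CycleIndices {3 + k} (s≤s (s≤s (s≤s z≤n)))
    open Graph w using (Adj-sym; Adj-≢)
    position : Fin n → Fin n
    position y = σ ⟨$⟩ˡ y
    last = argmax (λ r → toℕ (position (c r)))
    t = proj₁ last
    earlier : ∀ r → Adj w (c t) (c r) → EarlierNbr w σ (position (c t)) (position (c r))
    earlier r a = NP.≤∧≢⇒< (proj₂ last r) (λ e → Adj-≢ a (sym (trans (sym (inverseʳ σ))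
                                                           (trans (cong (σ ⟨$⟩ʳ_) (FP.toℕ-injective e)) (inverseʳ σ)))))
                , subst₂ (Adj w) (sym (inverseʳ σ)) (sym (inverseʳ σ)) a
    to-previous : Adj w (c t) (c (previous t))
    to-previous = Adj-sym (subst (λ z → Adj w (c (previous t)) (c z)) (next-previous t) (adjacent (previous t)))
    chord : Adj w (c (previous t)) (c (next t))
    chord = subst₂ (Adj w) (inverseʳ σ) (inverseʳ σ)
              (peo (position (c t)) (position (c (previous t))) (position (c (next t)))
                   (earlier (previous t) to-previous) (earlier (next t) (adjacent t))
                   (λ e → previous≢next t (injective (trans (sym (inverseʳ σ)) (trans (cong (σ ⟨$⟩ʳ_) e) (inverseʳ σ))))))

corollary6p3 : (n : ℕ) (w : S n) → ¬ Contains3412 w → ¬ Contains4231 w →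
    Chordal w
    × Σ (Permutation′ n) (IsNicePEO w)
    × Σ (List (Orientation n)) (EnumeratesAcyclicOrientations w)
    × (∀ (L : List (Orientation n)) → EnumeratesAcyclicOrientations w L →
       ∀ (σ : Permutation′ n) → IsPEO w σ →
       ∀ (q : ℕ) → R-via L q ≡ expProduct w σ q)
corollary6p3 n w ¬3412 ¬4231 =
  chordal w (proj₁ nice-peo) (proj₁ (proj₂ nice-peo)) ,
  nice-peo ,
  (proj₁ (enumeration whole) , Equivalence.from (enumerates-whole _) (proj₂ (enumeration whole))) ,
  λ L enumerates σ peo q → begin
    R-via L q                 ≡⟨ R-any (Equivalence.to (enumerates-whole L) enumerates) q ⟩
    R whole q                 ≡⟨ EliminationProduct.R-whole w ¬3412 ¬4231 σ peo q ⟩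
    expProduct w σ q          ∎
  where
    open ≡-Reasoning
    open Graph w using (whole; enumerates-whole)
    open NiceOrdering w ¬3412 ¬4231 using (nice-peo)
    open Enumeration w ¬3412 ¬4231 using (enumeration; R; R-any)
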